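{- Let $F = \{f_n\}_{n \in \mathbb{N}}$ be a family of Boolean functions. Let $L\colon \mathbb{N} \to \mathbb{N}$ be such that for each $n \in \mathbb{N}$, the lower bound $L(n)$ for $\mathrm{NBP}(f_n)$ or $\oplus\mathrm{BP}(f_n)$ has been obtained using the simple Nečiporuk lower bound method. Then $L(n) \in O\Bigl(\frac{n^{3/2}}{\log_2 n}\Bigr)$.
   Context: For an $n$-ary Boolean function $f$ and $V \subseteq [n]$, $r_V(f)$ denotes the number of distinct subfunctions $f|_\rho\colon\{0,1\}^V\to\{0,1\}$ obtained by fixing the variables outside $V$ by some $\rho \in \{0,1\}^{[n]\setminus V}$. A (nondeterministic) branching program (NBP) is a directed graph with a start vertex $s$, two sinks $t_0,t_1$, each non-sink vertex labelled by an input variable and arcs labelled $0$ or $1$; on input $a$ one keeps the arcs consistent with $a$; an NBP accepts iff there is a path from $s$ to $t_1$, and the same graph read as a parity branching program ($\oplus$BP) accepts iff the number of such paths is odd. $\mathrm{NBP}(f)$ and $\oplus\mathrm{BP}(f)$ denote the minimum number of non-sink vertices of an NBP, respectively $\oplus$BP, computing $f$. For $\mathbf{M} \in \{\mathrm{NBP}, \oplus\mathrm{BP}\}$, $\mathbf{M}_{sem}(n,s)$ is the number of distinct $n$-ary Boolean functions (on a fixed variable set) of complexity at most $s$ under $\mathbf{M}$. The simple Nečiporuk lower bound method for $\mathbf{M}$ consists of: (1) giving a non-decreasing $b\colon\mathbb{N}_{>0}\to\mathbb{N}$ such that for every $n$, every $n$-ary Boolean function $f$ on $V$ depending on all its inputs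 and every partition $V_1,\dots,V_p$ of $V$, $\sum_{i=1}^p \max\{|V_i|, \min\{s \in \mathbb{N} \mid \mathbf{M}_{sem}(|V_i|,s) \ge r_{V_i}(f)\}\} \ge \sum_{i=1}^p b(r_{V_i}(f))$ (such $b$ is a simple Nečiporuk function for $\mathbf{M}$); (2) for a given function $g$ depending on all variables in $V$, choosing a partition $V_1,\dots,V_p$ of $V$ and concluding $\mathbf{M}(g) \ge \sum_{i=1}^p b(r_{V_i}(g))$. -}

module Defs where

open import Data.Nat using (ℕ; zero; suc; _≤_; _<_; _⊔_; _%_; _≡ᵇ_)
open import Data.Bool using (Bool; true; false; if_then_else_; not)
import Data.Bool as Bool
open import Data.Fin using (Fin; toℕ)
import Data.Fin as Fin
open import Data.Fin.Subset using (Subset; ∣_∣)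
open import Data.Vec using (Vec; []; _∷_; lookup; tabulate; _[_]%=_)
open import Data.List using (List; []; _∷_; _++_; map; length; upTo; allFin; deduplicate)
import Data.List as List
open import Data.Nat.ListAction using (sum)
open import Data.List.Properties using (≡-dec)
open import Data.List.Relation.Unary.All using (All)
open import Data.List.Relation.Unary.AllPairs using (AllPairs)
open import Data.Sum using (_⊎_; inj₁; inj₂)
open import Data.Product using (Σ; ∃; ∃-syntax; _×_; _,_)
open import Relation.Binary.PropositionalEquality using (_≡_; _≢_)
open import Relation.Nullary using (¬_)
open import Relation.Nullary.Decidable using (⌊_⌋)

BoolFun : ℕ → Set
BoolFun n = Vec Bool n → Bool

allVecs : (n : ℕ) → List (Vec Bool n)
allVecs zero = [] ∷ []
allVecs (suc n) = map (false ∷_) (allVecs n) ++ map (true ∷_) (allVecs n)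

data Model : Set where
  NBP ParityBP : Model

-- Nodes of a program with k non-sink vertices: inj₁ u (non-sink), inj₂ b (sink t_b)
Node : ℕ → Set
Node k = Fin k ⊎ Bool

allNodes : (k : ℕ) → List (Node k)
allNodes k = map inj₁ (allFin k) ++ (inj₂ false ∷ inj₂ true ∷ [])

-- Acyclicity is expressed by a topological numbering of non-sink vertices.
record BP (n k : ℕ) : Set where
  field
    start   : Node k
    label   : Fin k → Fin n
    arc     : Fin k → Bool → Node k → Bool
    acyclic : ∀ u c v → arc u c (inj₁ v) ≡ true → toℕ u < toℕ v

open BP public

pathsLen : ∀ {n k} → BP n k → Vec Bool n → ℕ → Node k → ℕ
pathsLen P x zero (inj₂ true) = 1
pathsLen P x zero (inj₂ false) = 0
pathsLen P x zero (inj₁ u) = 0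
pathsLen P x (suc ℓ) (inj₂ b) = 0
pathsLen {k = k} P x (suc ℓ) (inj₁ u) =
  sum (map (λ v → if arc P u (lookup x (label P u)) v then pathsLen P x ℓ v else 0) (allNodes k))

-- number of consistent s–t_1 paths (in a DAG with k non-sink vertices, paths have ≤ k arcs)
numPaths : ∀ {n k} → BP n k → Vec Bool n → ℕ
numPaths {k = k} P x = sum (map (λ ℓ → pathsLen P x ℓ (start P)) (upTo (suc k)))

accepts : Model → ∀ {n k} → BP n k → Vec Bool n → Bool
accepts NBP P x = not (numPaths P x ≡ᵇ 0)
accepts ParityBP P x = numPaths P x % 2 ≡ᵇ 1

ComplexityAtMost : Model → (n : ℕ) → ℕ → BoolFun n → Set
ComplexityAtMost M n s g =
  ∃[ k ] (k ≤ s × Σ (BP n k) (λ P → ∀ x → accepts M P x ≡ g x))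

Distinct : ∀ {n} → BoolFun n → BoolFun n → Set
Distinct g h = ¬ (∀ x → g x ≡ h x)

MsemAtLeast : Model → (n s r : ℕ) → Set
MsemAtLeast M n s r =
  Σ (List (BoolFun n)) λ gs →
    (r ≤ length gs) × AllPairs Distinct gs × All (ComplexityAtMost M n s) gs

IsMinSize : Model → (m r s : ℕ) → Set
IsMinSize M m r s = MsemAtLeast M m s r × (∀ s' → s' < s → ¬ MsemAtLeast M m s' r)

merge : ∀ {n} → Subset n → Vec Bool n → Vec Bool n → Vec Bool n
merge V a ρ = tabulate (λ i → if lookup V i then lookup a i else lookup ρ i)

subTable : ∀ {n} → BoolFun n → Subset n → Vec Bool n → List Bool
subTable {n} f V ρ = map (λ a → f (merge V a ρ)) (allVecs n)

rV : ∀ {n} → Subset n → BoolFun n → ℕ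
rV {n} V f = length (deduplicate (≡-dec Bool._≟_) (map (subTable f V) (allVecs n)))

DependsOnAll : ∀ {n} → BoolFun n → Set
DependsOnAll {n} f = ∀ (i : Fin n) → ∃[ x ] (f x ≢ f (x [ i ]%= not))

-- Partitions into p nonempty blocks: π assigns each variable its block

Surj : ∀ {n p} → (Fin n → Fin p) → Set
Surj {n} {p} π = ∀ (i : Fin p) → ∃[ j ] (π j ≡ i)

block : ∀ {n p} → (Fin n → Fin p) → Fin p → Subset n
block π i = tabulate (λ j → ⌊ π j Fin.≟ i ⌋)

blockSize : ∀ {n p} → (Fin n → Fin p) → Fin p → ℕ
blockSize π i = ∣ block π i ∣

sumFin : (p : ℕ) → (Fin p → ℕ) → ℕ
sumFin p h = sum (List.tabulate h)

-- Simple Nečiporuk functions (b 0 is irrelevant: b is used on values ≥ 1)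

SimpleNecFun : Model → (ℕ → ℕ) → Set
SimpleNecFun M b =
  (∀ m m' → 1 ≤ m → m ≤ m' → b m ≤ b m') ×
  (∀ n (f : BoolFun n) → DependsOnAll f →
     ∀ p (π : Fin n → Fin p) → Surj π →
     ∀ (σ : Fin p → ℕ) → (∀ i → IsMinSize M (blockSize π i) (rV (block π i) f) (σ i)) →
     sumFin p (λ i → b (rV (block π i) f)) ≤ sumFin p (λ i → blockSize π i ⊔ σ i))

ObtainedBySimpleNec : Model → ∀ {n} → BoolFun n → ℕ → Set
ObtainedBySimpleNec M {n} g ℓ =
  DependsOnAll g ×
  Σ (ℕ → ℕ) λ b → SimpleNecFun M b ×
  Σ ℕ λ p → Σ (Fin n → Fin p) λ π → Surj π ×
  (ℓ ≡ sumFin p (λ i → b (rV (block π i) g)))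

-- A simple Nečiporuk bound is at most Σᵢ (|Vᵢ| + sᵢ), where sᵢ is the least s with
-- M_sem(|Vᵢ|, s) ≥ rᵢ. Since rᵢ ≤ 2^(2^k) for k = |Vᵢ| ⊓ (1 + log n), it suffices to exhibit 2^(2^k)
-- distinct functions of |Vᵢ| variables computed by programs with 3 · 2^⌈k/2⌉ nodes: a decision tree reads
-- the first ⌈k/2⌉ bits, and each of its leaves is joined by arbitrary arcs (one truth-table entry each) to
-- the leaves of a second tree that checks the next ⌊k/2⌋ bits on the way to t₁. Every input then has at
-- most one accepting path, so the same programs serve NBPs and ⊕BPs. Summing over the blocks gives
-- L · log n ≤ 8 · 2^⌈(log n)/2⌉ · n, whose square is at most 128 n³. The least sᵢ exist only classically,
-- which is harmless since the final inequality is decidable.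
module Submission where

open import Defs
open import Data.Nat
open import Data.Nat.Properties
open import Data.Nat.DivMod using (m≡m%n+[m/n]*n; m%n<n; m<n*o⇒m/o<n)
open import Data.Nat.Logarithm using (⌊log₂_⌋; ⌊log₂⌋-mono-≤; ⌊log₂⌊n/2⌋⌋≡⌊log₂n⌋∸1)
open import Data.Nat.Induction using (<-wellFounded)
open import Data.Nat.Tactic.RingSolver using (solve-∀)
open import Data.Nat.ListAction using (sum)
open import Data.Bool using (Bool; true; false; if_then_else_; _∧_)
import Data.Bool as Bool
open import Data.Bool.Properties using (∧-zeroʳ; ∧-identityʳ)
open import Data.Fin using (Fin; toℕ; fromℕ<)
open import Data.Fin.Properties using (toℕ<n; fromℕ<-toℕ; toℕ-fromℕ<)
import Data.Fin as Fin
open import Data.Fin.Subset using (Subset; ∣_∣)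
open import Data.Vec using (Vec; []; _∷_; lookup; tabulate)
open import Data.Vec.Properties using (lookup∘tabulate; ∷-injectiveʳ)
open import Data.List using (List; []; _∷_; _++_; map; length; filter; deduplicate; upTo; allFin)
open import Data.List.Properties using (filter-notAll; length-map; length-++; map-cong; ≡-dec; length-deduplicate; ∷-injective)
open import Data.List.Membership.Propositional using (_∈_)
open import Data.List.Membership.Propositional.Properties using (∈-filter⁺; ∈-allFin; ∈-upTo⁺; ∈-map⁺; ∈-map⁻; ∈-++⁺ˡ; ∈-++⁺ʳ; ∈-deduplicate⁻)
open import Data.List.Relation.Unary.Unique.DecPropositional.Properties using (deduplicate-!)
open import Data.List.Relation.Unary.Any using (here; there)
import Data.List.Relation.Unary.Any as Any
open import Data.List.Relation.Unary.All using (All; []; _∷_)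
import Data.List.Relation.Unary.All as All
open import Data.List.Relation.Unary.AllPairs using ([]; _∷_)
import Data.List.Relation.Unary.AllPairs as AllPairs
import Data.List.Relation.Unary.AllPairs.Properties as AllPairs
import Data.List.Relation.Unary.All.Properties as All
open import Data.List.Relation.Unary.Unique.Propositional using (Unique)
import Data.List.Relation.Unary.Unique.Propositional.Properties as Unique
open import Data.Product using (Σ; ∃-syntax; _×_; _,_; proj₁; proj₂)
open import Data.Empty using (⊥; ⊥-elim)
open import Data.Unit using (⊤)
open import Data.Sum using (inj₁; inj₂)
open import Data.Sum.Properties using (inj₁-injective)
open import Induction.WellFounded using (Acc; acc)
open import Relation.Binary.Definitions using (DecidableEquality)
open import Relation.Binary.PropositionalEquality
open import Function using (_∘_)
open import Relation.Nullary using (¬_; Dec; yes; no; does; ¬?; ¬¬-map)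
open import Relation.Nullary.Decidable using (⌊_⌋; isYes≗does; dec-true; dec-false; decidable-stable)

2*⌊n/2⌋≤n : ∀ n → 2 * ⌊ n /2⌋ ≤ n
2*⌊n/2⌋≤n n = begin
  2 * ⌊ n /2⌋         ≡⟨ cong (⌊ n /2⌋ +_) (+-identityʳ ⌊ n /2⌋) ⟩
  ⌊ n /2⌋ + ⌊ n /2⌋   ≤⟨ +-monoʳ-≤ ⌊ n /2⌋ (⌊n/2⌋≤⌈n/2⌉ n) ⟩
  ⌊ n /2⌋ + ⌈ n /2⌉   ≡⟨ ⌊n/2⌋+⌈n/2⌉≡n n ⟩
  n                   ∎
  where open ≤-Reasoning

n<2*[1+⌊n/2⌋] : ∀ n → n < 2 * suc ⌊ n /2⌋
n<2*[1+⌊n/2⌋] zero = s≤s z≤n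
n<2*[1+⌊n/2⌋] (suc zero) = s≤s (s≤s z≤n)
n<2*[1+⌊n/2⌋] (suc (suc n)) = begin-strict
  suc (suc n)                  <⟨ s≤s (s≤s (n<2*[1+⌊n/2⌋] n)) ⟩
  suc (suc (2 * suc ⌊ n /2⌋))  ≡⟨ sym (*-suc 2 (suc ⌊ n /2⌋)) ⟩
  2 * suc (suc ⌊ n /2⌋)        ∎
  where open ≤-Reasoning

n<2^n : ∀ n → n < 2 ^ n
n<2^n zero = s≤s z≤n
n<2^n (suc n) = begin-strict
  suc n          <⟨ s≤s (n<2^n n) ⟩
  suc (2 ^ n)    ≡⟨ +-comm 1 (2 ^ n) ⟩
  2 ^ n + 1      ≤⟨ +-monoʳ-≤ (2 ^ n) (m^n>0 2 n) ⟩
  2 ^ n + 2 ^ n  ≡⟨ cong (2 ^ n +_) (sym (+-identityʳ (2 ^ n))) ⟩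
  2 ^ suc n      ∎
  where open ≤-Reasoning

⌊log₂⌋≡1+⌊log₂⌊n/2⌋⌋ : ∀ {n} → 2 ≤ n → ⌊log₂ n ⌋ ≡ suc ⌊log₂ ⌊ n /2⌋ ⌋
⌊log₂⌋≡1+⌊log₂⌊n/2⌋⌋ {n} 2≤n = begin
  ⌊log₂ n ⌋            ≡⟨ sym (m∸n+n≡m (⌊log₂⌋-mono-≤ 2≤n)) ⟩
  ⌊log₂ n ⌋ ∸ 1 + 1    ≡⟨ +-comm _ 1 ⟩
  suc (⌊log₂ n ⌋ ∸ 1)  ≡⟨ cong suc (sym (⌊log₂⌊n/2⌋⌋≡⌊log₂n⌋∸1 n)) ⟩
  suc ⌊log₂ ⌊ n /2⌋ ⌋  ∎
  where open ≡-Reasoning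

⌊log₂⌋-bounds : ∀ n → 1 ≤ n → 2 ^ ⌊log₂ n ⌋ ≤ n × n < 2 ^ suc ⌊log₂ n ⌋
⌊log₂⌋-bounds n = go n (<-wellFounded n)
  where
  go : ∀ n → Acc _<_ n → 1 ≤ n → 2 ^ ⌊log₂ n ⌋ ≤ n × n < 2 ^ suc ⌊log₂ n ⌋
  go n@(suc k) (acc rs) 1≤n with n ≟ 1
  ... | yes refl = s≤s z≤n , s≤s (s≤s z≤n)
  ... | no n≢1 = subst (λ l → 2 ^ l ≤ n × n < 2 ^ suc l) (sym (⌊log₂⌋≡1+⌊log₂⌊n/2⌋⌋ 2≤n))
          (≤-trans (*-monoʳ-≤ 2 (proj₁ ih)) (2*⌊n/2⌋≤n n) ,
           ≤-trans (n<2*[1+⌊n/2⌋] n) (*-monoʳ-≤ 2 (proj₂ ih)))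
    where
    2≤n : 2 ≤ n
    2≤n = ≤∧≢⇒< 1≤n (n≢1 ∘ sym)
    ih = go ⌊ n /2⌋ (rs (⌊n/2⌋<n k)) (⌊n/2⌋-mono 2≤n)

2^m<2^[1+n]⇒m≤n : ∀ {m n} → 2 ^ m < 2 ^ suc n → m ≤ n
2^m<2^[1+n]⇒m≤n p = ≮⇒≥ λ n<m → <⇒≱ p (^-monoʳ-≤ 2 n<m)

⌊log₂⌋-unique : ∀ {d n} → 2 ^ d ≤ n → n < 2 ^ suc d → ⌊log₂ n ⌋ ≡ d
⌊log₂⌋-unique {d} {n} lo hi = ≤-antisym
  (2^m<2^[1+n]⇒m≤n (≤-<-trans (proj₁ bounds) hi))
  (2^m<2^[1+n]⇒m≤n (≤-<-trans lo (proj₂ bounds)))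
  where bounds = ⌊log₂⌋-bounds n (≤-trans (m^n>0 2 d) lo)

module _ {A B : Set} (_≟ᴮ_ : DecidableEquality B) (R : A → B → Set)
         (R-injective : ∀ {x x′ y} → R x y → R x′ y → x ≡ x′) where

  Unique-injects⇒length≤ : ∀ {xs} ys → Unique xs → (∀ {x} → x ∈ xs → ∃[ y ] (y ∈ ys × R x y)) →
                           length xs ≤ length ys
  Unique-injects⇒length≤ {[]} ys _ _ = z≤n
  Unique-injects⇒length≤ {x ∷ xs} ys (x∉xs ∷ unique) cover with cover (here refl)
  ... | y , y∈ys , Rxy = begin-strict
    length xs     ≤⟨ Unique-injects⇒length≤ ys−y unique cover′ ⟩
    length ys−y   <⟨ filter-notAll (λ z → ¬? (z ≟ᴮ y)) ys (Any.map (λ y≡z z≢y → z≢y (sym y≡z)) y∈ys) ⟩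
    length ys     ∎
    where
    open ≤-Reasoning
    ys−y = filter (λ z → ¬? (z ≟ᴮ y)) ys
    cover′ : ∀ {x′} → x′ ∈ xs → ∃[ y′ ] (y′ ∈ ys−y × R x′ y′)
    cover′ {x′} x′∈xs with cover (there x′∈xs)
    ... | y′ , y′∈ys , Rx′y′ = y′ , ∈-filter⁺ (λ z → ¬? (z ≟ᴮ y)) y′∈ys y′≢y , Rx′y′
      where
      y′≢y : y′ ≢ y
      y′≢y refl = All.lookup x∉xs x′∈xs (R-injective Rxy Rx′y′)

boolToℕ : Bool → ℕ
boolToℕ true = 1
boolToℕ false = 0

boolToℕ≤1 : ∀ c → boolToℕ c ≤ 1
boolToℕ≤1 true = s≤s z≤n
boolToℕ≤1 false = z≤n

sumFin-cong : ∀ p {f g : Fin p → ℕ} → (∀ i → f i ≡ g i) → sumFin p f ≡ sumFin p g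
sumFin-cong zero e = refl
sumFin-cong (suc p) e = cong₂ _+_ (e Fin.zero) (sumFin-cong p (e ∘ Fin.suc))

sumFin-mono-≤ : ∀ p {f g : Fin p → ℕ} → (∀ i → f i ≤ g i) → sumFin p f ≤ sumFin p g
sumFin-mono-≤ zero e = z≤n
sumFin-mono-≤ (suc p) e = +-mono-≤ (e Fin.zero) (sumFin-mono-≤ p (e ∘ Fin.suc))

sumFin-+ : ∀ p (f g : Fin p → ℕ) → sumFin p (λ i → f i + g i) ≡ sumFin p f + sumFin p g
sumFin-+ zero f g = refl
sumFin-+ (suc p) f g = begin
  f₀ + g₀ + sumFin p (λ i → f (Fin.suc i) + g (Fin.suc i))  ≡⟨ cong (f₀ + g₀ +_) (sumFin-+ p (f ∘ Fin.suc) (g ∘ Fin.suc)) ⟩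
  f₀ + g₀ + (sumFin p (f ∘ Fin.suc) + sumFin p (g ∘ Fin.suc)) ≡⟨ interchange f₀ g₀ _ _ ⟩
  f₀ + sumFin p (f ∘ Fin.suc) + (g₀ + sumFin p (g ∘ Fin.suc)) ∎
  where
  open ≡-Reasoning
  f₀ = f Fin.zero
  g₀ = g Fin.zero
  interchange : ∀ a b c d → a + b + (c + d) ≡ a + c + (b + d)
  interchange = solve-∀

sumFin-*ˡ : ∀ p c (f : Fin p → ℕ) → sumFin p (λ i → c * f i) ≡ c * sumFin p f
sumFin-*ˡ zero c f = sym (*-zeroʳ c)
sumFin-*ˡ (suc p) c f = trans (cong (c * f Fin.zero +_) (sumFin-*ˡ p c (f ∘ Fin.suc)))
                              (sym (*-distribˡ-+ c (f Fin.zero) _))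

sumFin-indicator : ∀ p (k : Fin p) → sumFin p (λ i → boolToℕ ⌊ k Fin.≟ i ⌋) ≡ 1
sumFin-indicator (suc p) Fin.zero = cong suc (sumFin-zero p)
  where
  sumFin-zero : ∀ p → sumFin p (λ i → boolToℕ ⌊ Fin.zero {p} Fin.≟ Fin.suc i ⌋) ≡ 0
  sumFin-zero zero = refl
  sumFin-zero (suc p) = sumFin-zero p
sumFin-indicator (suc p) (Fin.suc k) =
  trans (sumFin-cong p λ i → cong boolToℕ (suc-≟ k i)) (sumFin-indicator p k)
  where
  suc-≟ : ∀ k i → ⌊ Fin.suc k Fin.≟ Fin.suc i ⌋ ≡ ⌊ k Fin.≟ i ⌋
  suc-≟ k i with k Fin.≟ i
  ... | yes _ = refl
  ... | no _ = refl

∣c∷V∣ : ∀ {n} c (V : Subset n) → ∣ c ∷ V ∣ ≡ boolToℕ c + ∣ V ∣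
∣c∷V∣ true V = refl
∣c∷V∣ false V = refl

sumFin-blockSize : ∀ n p (π : Fin n → Fin p) → sumFin p (blockSize π) ≡ n
sumFin-blockSize zero p π = sumFin-∅ p
  where
  sumFin-∅ : ∀ p → sumFin p (λ _ → 0) ≡ 0
  sumFin-∅ zero = refl
  sumFin-∅ (suc p) = sumFin-∅ p
sumFin-blockSize (suc n) p π = begin
  sumFin p (blockSize π)
    ≡⟨ sumFin-cong p (λ i → ∣c∷V∣ ⌊ π Fin.zero Fin.≟ i ⌋ (block (π ∘ Fin.suc) i)) ⟩
  sumFin p (λ i → boolToℕ ⌊ π Fin.zero Fin.≟ i ⌋ + blockSize (π ∘ Fin.suc) i)
    ≡⟨ sumFin-+ p _ _ ⟩
  sumFin p (λ i → boolToℕ ⌊ π Fin.zero Fin.≟ i ⌋) + sumFin p (blockSize (π ∘ Fin.suc))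
    ≡⟨ cong₂ _+_ (sumFin-indicator p (π Fin.zero)) (sumFin-blockSize n p (π ∘ Fin.suc)) ⟩
  suc n ∎
  where open ≡-Reasoning

lookup≡true⇒1≤∣V∣ : ∀ {n} (V : Subset n) j → lookup V j ≡ true → 1 ≤ ∣ V ∣
lookup≡true⇒1≤∣V∣ (true ∷ V) Fin.zero _ = s≤s z≤n
lookup≡true⇒1≤∣V∣ (c ∷ V) (Fin.suc j) e = begin
  1                    ≤⟨ lookup≡true⇒1≤∣V∣ V j e ⟩
  ∣ V ∣                ≤⟨ m≤n+m _ (boolToℕ c) ⟩
  boolToℕ c + ∣ V ∣    ≡⟨ sym (∣c∷V∣ c V) ⟩
  ∣ c ∷ V ∣            ∎
  where open ≤-Reasoning

Surj⇒1≤blockSize : ∀ {n p} (π : Fin n → Fin p) → Surj π → ∀ i → 1 ≤ blockSize π i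
Surj⇒1≤blockSize π surj i with surj i
... | j , πj≡i = lookup≡true⇒1≤∣V∣ (block π i) j
                   (trans (lookup∘tabulate _ j) (trans (isYes≗does (π j Fin.≟ i)) (dec-true (π j Fin.≟ i) πj≡i)))

length-map++map : ∀ {A B : Set} (f g : A → B) xs → length (map f xs ++ map g xs) ≡ 2 * length xs
length-map++map f g xs = begin
  length (map f xs ++ map g xs)          ≡⟨ length-++ (map f xs) ⟩
  length (map f xs) + length (map g xs)  ≡⟨ cong₂ _+_ (length-map f xs) (length-map g xs) ⟩
  length xs + length xs                  ≡⟨ cong (length xs +_) (sym (+-identityʳ _)) ⟩
  2 * length xs                          ∎
  where open ≡-Reasoning

length-allVecs : ∀ n → length (allVecs n) ≡ 2 ^ n
length-allVecs zero = refl
length-allVecs (suc n) = trans (length-map++map _ _ (allVecs n)) (cong (2 *_) (length-allVecs n))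

allLists : ℕ → List (List Bool)
allLists zero = [] ∷ []
allLists (suc N) = map (false ∷_) (allLists N) ++ map (true ∷_) (allLists N)

length-allLists : ∀ N → length (allLists N) ≡ 2 ^ N
length-allLists zero = refl
length-allLists (suc N) = trans (length-map++map _ _ (allLists N)) (cong (2 *_) (length-allLists N))

∈-allLists : ∀ (l : List Bool) → l ∈ allLists (length l)
∈-allLists [] = here refl
∈-allLists (false ∷ l) = ∈-++⁺ˡ (∈-map⁺ (false ∷_) (∈-allLists l))
∈-allLists (true ∷ l) = ∈-++⁺ʳ (map (false ∷_) (allLists (length l))) (∈-map⁺ (true ∷_) (∈-allLists l))

assignmentsOn : ∀ {n} → Subset n → List (Vec Bool n)
assignmentsOn [] = [] ∷ []
assignmentsOn (true ∷ V) = map (false ∷_) (assignmentsOn V) ++ map (true ∷_) (assignmentsOn V)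
assignmentsOn (false ∷ V) = map (false ∷_) (assignmentsOn V)

length-assignmentsOn : ∀ {n} (V : Subset n) → length (assignmentsOn V) ≡ 2 ^ ∣ V ∣
length-assignmentsOn [] = refl
length-assignmentsOn (true ∷ V) =
  trans (length-map++map _ _ (assignmentsOn V)) (cong (2 *_) (length-assignmentsOn V))
length-assignmentsOn (false ∷ V) = trans (length-map _ (assignmentsOn V)) (length-assignmentsOn V)

falseOutside : ∀ {n} → Subset n → Vec Bool n → Vec Bool n
falseOutside [] [] = []
falseOutside (true ∷ V) (x ∷ a) = x ∷ falseOutside V a
falseOutside (false ∷ V) (x ∷ a) = false ∷ falseOutside V a

falseOutside-∈ : ∀ {n} (V : Subset n) a → falseOutside V a ∈ assignmentsOn V
falseOutside-∈ [] [] = here refl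
falseOutside-∈ (true ∷ V) (false ∷ a) = ∈-++⁺ˡ (∈-map⁺ (false ∷_) (falseOutside-∈ V a))
falseOutside-∈ (true ∷ V) (true ∷ a) =
  ∈-++⁺ʳ (map (false ∷_) (assignmentsOn V)) (∈-map⁺ (true ∷_) (falseOutside-∈ V a))
falseOutside-∈ (false ∷ V) (x ∷ a) = ∈-map⁺ (false ∷_) (falseOutside-∈ V a)

merge-falseOutside : ∀ {n} (V : Subset n) a ρ → merge V a ρ ≡ merge V (falseOutside V a) ρ
merge-falseOutside [] [] [] = refl
merge-falseOutside (true ∷ V) (x ∷ a) (r ∷ ρ) = cong (x ∷_) (merge-falseOutside V a ρ)
merge-falseOutside (false ∷ V) (x ∷ a) (r ∷ ρ) = cong (r ∷_) (merge-falseOutside V a ρ)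

map-≡⇒≗-on : ∀ {A B : Set} {g h : A → B} {xs x} → map g xs ≡ map h xs → x ∈ xs → g x ≡ h x
map-≡⇒≗-on {xs = _ ∷ _} e (here refl) = proj₁ (∷-injective e)
map-≡⇒≗-on {xs = _ ∷ _} e (there x∈xs) = map-≡⇒≗-on (proj₂ (∷-injective e)) x∈xs

module _ {n} (f : BoolFun n) (V : Subset n) where

  shortTable : Vec Bool n → List Bool
  shortTable ρ = map (λ z → f (merge V z ρ)) (assignmentsOn V)

  shortTable-determines-subTable : ∀ ρ ρ′ → shortTable ρ ≡ shortTable ρ′ → subTable f V ρ ≡ subTable f V ρ′
  shortTable-determines-subTable ρ ρ′ e = map-cong agree (allVecs n)
    where
    agree : ∀ a → f (merge V a ρ) ≡ f (merge V a ρ′)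
    agree a = begin
      f (merge V a ρ)                     ≡⟨ cong f (merge-falseOutside V a ρ) ⟩
      f (merge V (falseOutside V a) ρ)    ≡⟨ map-≡⇒≗-on e (falseOutside-∈ V a) ⟩
      f (merge V (falseOutside V a) ρ′)   ≡⟨ cong f (sym (merge-falseOutside V a ρ′)) ⟩
      f (merge V a ρ′)                    ∎
      where open ≡-Reasoning

  rV≤2^n : rV V f ≤ 2 ^ n
  rV≤2^n = begin
    rV V f                                  ≤⟨ length-deduplicate _ (map (subTable f V) (allVecs n)) ⟩
    length (map (subTable f V) (allVecs n)) ≡⟨ length-map (subTable f V) (allVecs n) ⟩
    length (allVecs n)                      ≡⟨ length-allVecs n ⟩
    2 ^ n                                   ∎
    where open ≤-Reasoning

  rV≤2^2^∣V∣ : rV V f ≤ 2 ^ (2 ^ ∣ V ∣)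
  rV≤2^2^∣V∣ = ≤-trans
    (Unique-injects⇒length≤ (≡-dec Bool._≟_) Tabulates Tabulates-injective (allLists (2 ^ ∣ V ∣))
      (deduplicate-! (≡-dec Bool._≟_) (map (subTable f V) (allVecs n))) cover)
    (≤-reflexive (length-allLists (2 ^ ∣ V ∣)))
    where
    Tabulates : List Bool → List Bool → Set
    Tabulates t s = ∃[ ρ ] (t ≡ subTable f V ρ × s ≡ shortTable ρ)
    Tabulates-injective : ∀ {t t′ s} → Tabulates t s → Tabulates t′ s → t ≡ t′
    Tabulates-injective (ρ , refl , refl) (ρ′ , refl , e) = shortTable-determines-subTable ρ ρ′ e
    cover : ∀ {t} → t ∈ deduplicate (≡-dec Bool._≟_) (map (subTable f V) (allVecs n)) →
            ∃[ s ] (s ∈ allLists (2 ^ ∣ V ∣) × Tabulates t s)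
    cover t∈ with ∈-map⁻ (subTable f V) (∈-deduplicate⁻ (≡-dec Bool._≟_) (map (subTable f V) (allVecs n)) t∈)
    ... | ρ , _ , t≡ = shortTable ρ , subst (λ k → shortTable ρ ∈ allLists k) length-shortTable (∈-allLists (shortTable ρ)) , ρ , t≡ , refl
      where
      length-shortTable : length (shortTable ρ) ≡ 2 ^ ∣ V ∣
      length-shortTable = trans (length-map _ (assignmentsOn V)) (length-assignmentsOn V)

¬¬-least : ∀ (P : ℕ → Set) {s} → P s → ¬ ¬ (∃[ s ] (P s × (∀ s′ → s′ < s → ¬ P s′)))
¬¬-least P {s} = go s (<-wellFounded s)
  where
  go : ∀ s → Acc _<_ s → P s → ¬ ¬ (∃[ s ] (P s × (∀ s′ → s′ < s → ¬ P s′)))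
  go s (acc rs) Ps none = none (s , Ps , λ s′ s′<s Ps′ → go s′ (rs s′<s) Ps′ none)

¬¬-finiteChoice : ∀ p {B : Fin p → ℕ → Set} → (∀ i → ¬ ¬ (∃[ s ] B i s)) →
                  ¬ ¬ (Σ (Fin p → ℕ) λ σ → ∀ i → B i (σ i))
¬¬-finiteChoice zero _ none = none ((λ ()) , λ ())
¬¬-finiteChoice (suc p) {B} choices none =
  choices Fin.zero λ (s₀ , B₀s₀) → ¬¬-finiteChoice p (choices ∘ Fin.suc) λ (σ , Bσ) →
    none ((λ { Fin.zero → s₀ ; (Fin.suc i) → σ i }) , λ { Fin.zero → B₀s₀ ; (Fin.suc i) → Bσ i })

⌊2*y+c/2⌋≡y : ∀ y c → ⌊ 2 * y + boolToℕ c /2⌋ ≡ y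
⌊2*y+c/2⌋≡y zero true = refl
⌊2*y+c/2⌋≡y zero false = refl
⌊2*y+c/2⌋≡y (suc y) c = trans (cong (λ z → ⌊ z + boolToℕ c /2⌋) (*-suc 2 y)) (cong suc (⌊2*y+c/2⌋≡y y c))

2*y+c<2*N : ∀ {y N} c → y < N → 2 * y + boolToℕ c < 2 * N
2*y+c<2*N {y} {N} c y<N = begin-strict
  2 * y + boolToℕ c  ≤⟨ +-monoʳ-≤ (2 * y) (boolToℕ≤1 c) ⟩
  2 * y + 1          ≡⟨ +-comm (2 * y) 1 ⟩
  suc (2 * y)        <⟨ n<1+n _ ⟩
  2 + 2 * y          ≡⟨ sym (*-suc 2 y) ⟩
  2 * suc y          ≤⟨ *-monoʳ-≤ 2 y<N ⟩
  2 * N              ∎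
  where open ≤-Reasoning

<⇒≤∸1 : ∀ {x N} → x < N → x ≤ N ∸ 1
<⇒≤∸1 {N = suc N} (s≤s x≤N) = x≤N

≤∸1⇒< : ∀ {x N} → 1 ≤ N → x ≤ N ∸ 1 → x < N
≤∸1⇒< {N = suc N} _ x≤N = s≤s x≤N

does-true⇒ : ∀ {P : Set} (P? : Dec P) → does P? ≡ true → P
does-true⇒ (yes p) _ = p

infix 4 _==_ _<=_

_==_ : ℕ → ℕ → Bool
m == n = does (m ≟ n)

_<=_ : ℕ → ℕ → Bool
m <= n = does (m ≤? n)

==-suc : ∀ m n → (suc m == suc n) ≡ (m == n)
==-suc m n = refl

==-true : ∀ {m n} → m ≡ n → (m == n) ≡ true
==-true {m} {n} = dec-true (m ≟ n)

==-false : ∀ {m n} → m ≢ n → (m == n) ≡ false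
==-false {m} {n} = dec-false (m ≟ n)

==-sound : ∀ {m n} → (m == n) ≡ true → m ≡ n
==-sound {m} {n} = does-true⇒ (m ≟ n)

<=-true : ∀ {m n} → m ≤ n → (m <= n) ≡ true
<=-true {m} {n} = dec-true (m ≤? n)

<=-false : ∀ {m n} → ¬ m ≤ n → (m <= n) ≡ false
<=-false {m} {n} = dec-false (m ≤? n)

==-halve : ∀ e t c → ((e == 2 * ⌊ e /2⌋ + boolToℕ c) ∧ (⌊ e /2⌋ == t)) ≡ (e == 2 * t + boolToℕ c)
==-halve e t c with ⌊ e /2⌋ ≟ t
... | yes refl rewrite ==-true {⌊ e /2⌋} refl = ∧-identityʳ _
... | no ⌊e/2⌋≢t rewrite ==-false ⌊e/2⌋≢t | ∧-zeroʳ (e == 2 * ⌊ e /2⌋ + boolToℕ c) =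
  sym (==-false λ e≡ → ⌊e/2⌋≢t (trans (cong ⌊_/2⌋ e≡) (⌊2*y+c/2⌋≡y t c)))

-- The depth of node i of a complete binary tree in heap numbering (root 1, children 2i and 2i+1).
depth : ℕ → ℕ
depth = ⌊log₂_⌋

depth-child : ∀ i c → 1 ≤ i → depth (2 * i + boolToℕ c) ≡ suc (depth i)
depth-child i c 1≤i = trans (⌊log₂⌋≡1+⌊log₂⌊n/2⌋⌋ (≤-trans (*-monoʳ-≤ 2 1≤i) (m≤m+n _ _)))
                            (cong (suc ∘ ⌊log₂_⌋) (⌊2*y+c/2⌋≡y i c))

1≤depth : ∀ e → 2 ≤ e → 1 ≤ depth e
1≤depth e = ⌊log₂⌋-mono-≤ {2} {e}

sum-map-single : ∀ {A : Set} (h : A → ℕ) {xs t} → Unique xs → t ∈ xs → (∀ v → v ≢ t → h v ≡ 0) →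
                 sum (map h xs) ≡ h t
sum-map-single h {x ∷ xs} (x∉xs ∷ _) (here refl) vanish =
  trans (cong (h x +_) (sum-zero xs x∉xs)) (+-identityʳ (h x))
  where
  sum-zero : ∀ ys → All (x ≢_) ys → sum (map h ys) ≡ 0
  sum-zero [] _ = refl
  sum-zero (y ∷ ys) (x≢y ∷ x∉ys) = cong₂ _+_ (vanish y (x≢y ∘ sym)) (sum-zero ys x∉ys)
sum-map-single h {x ∷ xs} (x∉xs ∷ unique) (there t∈xs) vanish =
  trans (cong (_+ sum (map h xs)) (vanish x λ { refl → All.lookup x∉xs t∈xs refl }))
        (sum-map-single h unique t∈xs vanish)

∈-allNodes : ∀ {k} (v : Node k) → v ∈ allNodes k
∈-allNodes (inj₁ p) = ∈-++⁺ˡ (∈-map⁺ inj₁ (∈-allFin p))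
∈-allNodes {k} (inj₂ false) = ∈-++⁺ʳ (map inj₁ (allFin k)) (here refl)
∈-allNodes {k} (inj₂ true) = ∈-++⁺ʳ (map inj₁ (allFin k)) (there (here refl))

allNodes-unique : ∀ k → Unique (allNodes k)
allNodes-unique k = Unique.++⁺ (Unique.map⁺ inj₁-injective (Unique.allFin⁺ k)) (((λ ()) ∷ []) ∷ [] ∷ []) disjoint
  where
  disjoint : ∀ {v} → v ∈ map inj₁ (allFin k) × v ∈ (inj₂ false ∷ inj₂ true ∷ []) → ⊥
  disjoint (v∈ , here refl) with ∈-map⁻ inj₁ v∈
  ... | _ , _ , ()
  disjoint (v∈ , there (here refl)) with ∈-map⁻ inj₁ v∈
  ... | _ , _ , ()

sum-allNodes-single : ∀ {k} (h : Node k → ℕ) t → (∀ v → v ≢ t → h v ≡ 0) → sum (map h (allNodes k)) ≡ h t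
sum-allNodes-single {k} h t = sum-map-single h (allNodes-unique k) (∈-allNodes t)

if-indicator-swap : ∀ g q → (if g then (if q then 1 else 0) else 0) ≡ (if q then boolToℕ g else 0)
if-indicator-swap true true = refl
if-indicator-swap true false = refl
if-indicator-swap false true = refl
if-indicator-swap false false = refl

if-indicator-∧ : ∀ p q r → (if p then (if q ∧ r then 1 else 0) else 0) ≡ (if q ∧ (p ∧ r) then 1 else 0)
if-indicator-∧ true q r = refl
if-indicator-∧ false true r = refl
if-indicator-∧ false false r = refl

dropTopBitBy : ∀ r t → Dec (2 ^ r ≤ t) → ℕ
dropTopBitBy r t (yes _) = t ∸ 2 ^ r
dropTopBitBy r t (no _) = t

dropTopBit : ℕ → ℕ → ℕ
dropTopBit r t = dropTopBitBy r t (2 ^ r ≤? t)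

-- binaryDigit r t j is the j-th most significant of the r binary digits of t.
binaryDigit : ℕ → ℕ → ℕ → Bool
binaryDigit zero t j = false
binaryDigit (suc r) t zero = does (2 ^ r ≤? t)
binaryDigit (suc r) t (suc j) = binaryDigit r (dropTopBit r t) j

dropTopBit-< : ∀ r t → t < 2 ^ suc r → dropTopBit r t < 2 ^ r
dropTopBit-< r t t< = go (2 ^ r ≤? t)
  where
  go : (top? : Dec (2 ^ r ≤ t)) → dropTopBitBy r t top? < 2 ^ r
  go (yes 2^r≤t) = +-cancelˡ-< (2 ^ r) _ _ (begin-strict
    2 ^ r + (t ∸ 2 ^ r)  ≡⟨ m+[n∸m]≡n 2^r≤t ⟩
    t                    <⟨ t< ⟩
    2 * 2 ^ r            ≡⟨ cong (2 ^ r +_) (+-identityʳ (2 ^ r)) ⟩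
    2 ^ r + 2 ^ r        ∎)
    where open ≤-Reasoning
  go (no 2^r≰t) = ≰⇒> 2^r≰t

prependTopBit : ∀ i r t (top? : Dec (2 ^ r ≤ t)) →
                (2 * i + boolToℕ (does top?)) * 2 ^ r + dropTopBitBy r t top? ≡ i * 2 ^ suc r + t
prependTopBit i r t (yes 2^r≤t) = trans (shift1 i (2 ^ r) (t ∸ 2 ^ r)) (cong (i * (2 * 2 ^ r) +_) (m+[n∸m]≡n 2^r≤t))
  where
  shift1 : ∀ i P s → (2 * i + 1) * P + s ≡ i * (2 * P) + (P + s)
  shift1 = solve-∀
prependTopBit i r t (no _) = shift0 i (2 ^ r) t
  where
  shift0 : ∀ i P t → (2 * i + 0) * P + t ≡ i * (2 * P) + t
  shift0 = solve-∀

-- Node codes of the universal program: tree i is node i (1 ≤ i < 2^a) of a complete binary decision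
-- tree in heap numbering; check e (1 ≤ e < 2^(1+b)) is node e of a second such tree, traversed from
-- the leaves towards its root check 1 = t₁, so that it is reached exactly when the bits read spell e.
data Code : Set where
  tree check : ℕ → Code
  reject : Code

module Layout (m′ a′ b : ℕ) where

  m = suc m′
  a = suc a′

  #tree = 2 ^ a ∸ 1
  maxCheck = 2 ^ suc b ∸ 1
  #nodes = #tree + (maxCheck ∸ 1)

  -- Non-sink node p: first the tree nodes, then the check nodes by decreasing e, so that all arcs go forward.
  codeAt : ℕ → Code
  codeAt p with p <? #tree
  ... | yes _ = tree (suc p)
  ... | no _ = check (maxCheck ∸ (p ∸ #tree))

  code : Node #nodes → Code
  code (inj₁ p) = codeAt (toℕ p)
  code (inj₂ true) = check 1
  code (inj₂ false) = reject

  nodeAt : ℕ → Node #nodes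
  nodeAt p with p <? #nodes
  ... | yes p< = inj₁ (fromℕ< p<)
  ... | no _ = inj₂ false

  node : Code → Node #nodes
  node (tree i) = nodeAt (i ∸ 1)
  node (check 1) = inj₂ true
  node (check e) = nodeAt (#tree + (maxCheck ∸ e))
  node reject = inj₂ false

  -- Out-of-range variable indices are clamped to 0; they never occur on a node.
  varIndex : ℕ → Fin m
  varIndex j with j <? m
  ... | yes j< = fromℕ< j<
  ... | no _ = Fin.zero

  bitAt : Vec Bool m → ℕ → Bool
  bitAt x j = lookup x (varIndex j)

  varOf : Code → ℕ
  varOf (tree i) = depth i
  varOf (check e) = a′ + depth e
  varOf reject = 0

  2≤2^a : 2 ≤ 2 ^ a
  2≤2^a = *-monoʳ-≤ 2 (m^n>0 2 a′)

  2≤2^[1+b] : 2 ≤ 2 ^ suc b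
  2≤2^[1+b] = *-monoʳ-≤ 2 (m^n>0 2 b)

  1≤maxCheck : 1 ≤ maxCheck
  1≤maxCheck = ∸-monoˡ-≤ 1 2≤2^[1+b]

  data CodeView (p : ℕ) : Code → Set where
    isTree : p < #tree → CodeView p (tree (suc p))
    isCheck : #tree ≤ p → 2 ≤ maxCheck ∸ (p ∸ #tree) → CodeView p (check (maxCheck ∸ (p ∸ #tree)))

  p∸#tree<maxCheck∸1 : ∀ p → p < #nodes → #tree ≤ p → p ∸ #tree < maxCheck ∸ 1
  p∸#tree<maxCheck∸1 p p<#nodes #tree≤p =
    +-cancelˡ-< #tree (p ∸ #tree) (maxCheck ∸ 1) (subst (_< #nodes) (sym (m+[n∸m]≡n #tree≤p)) p<#nodes)

  2≤N∸q : ∀ N q → q < N ∸ 1 → 2 ≤ N ∸ q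
  2≤N∸q (suc (suc N)) zero _ = s≤s (s≤s z≤n)
  2≤N∸q (suc (suc N)) (suc q) (s≤s q<) = 2≤N∸q (suc N) q q<

  codeView : ∀ p → p < #nodes → CodeView p (codeAt p)
  codeView p p<#nodes with p <? #tree
  ... | yes p<#tree = isTree p<#tree
  ... | no p≮#tree = isCheck (≮⇒≥ p≮#tree)
                       (2≤N∸q maxCheck (p ∸ #tree) (p∸#tree<maxCheck∸1 p p<#nodes (≮⇒≥ p≮#tree)))

  InRange : Code → Set
  InRange (tree i) = 1 ≤ i × i < 2 ^ a
  InRange (check e) = 1 ≤ e × e ≤ maxCheck
  InRange reject = ⊤

  suc-<2^a : ∀ {p} → p < #tree → suc p < 2 ^ a
  suc-<2^a = ≤∸1⇒< (≤-trans (s≤s z≤n) 2≤2^a)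

  code-inRange : ∀ v → InRange (code v)
  code-inRange (inj₂ true) = s≤s z≤n , 1≤maxCheck
  code-inRange (inj₂ false) = _
  code-inRange (inj₁ p) with codeAt (toℕ p) | codeView (toℕ p) (toℕ<n p)
  ... | _ | isTree p< = s≤s z≤n , suc-<2^a p<
  ... | _ | isCheck _ 2≤e = ≤-trans (s≤s z≤n) 2≤e , m∸n≤m maxCheck (toℕ p ∸ #tree)

  nodeAt-< : ∀ p (p< : p < #nodes) → nodeAt p ≡ inj₁ (fromℕ< p<)
  nodeAt-< p p< with p <? #nodes
  ... | yes _ = refl
  ... | no p≮ = ⊥-elim (p≮ p<)

  nodeAt-toℕ : ∀ p → nodeAt (toℕ p) ≡ inj₁ p
  nodeAt-toℕ p = trans (nodeAt-< (toℕ p) (toℕ<n p)) (cong inj₁ (fromℕ<-toℕ p (toℕ<n p)))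

  node-check : ∀ e → 2 ≤ e → node (check e) ≡ nodeAt (#tree + (maxCheck ∸ e))
  node-check (suc (suc e)) _ = refl
  node-check (suc zero) (s≤s ())

  node∘code : ∀ v → node (code v) ≡ v
  node∘code (inj₂ true) = refl
  node∘code (inj₂ false) = refl
  node∘code (inj₁ p) with codeAt (toℕ p) | codeView (toℕ p) (toℕ<n p)
  ... | _ | isTree _ = nodeAt-toℕ p
  ... | _ | isCheck #tree≤p 2≤e = begin
    node (check (maxCheck ∸ (toℕ p ∸ #tree)))                ≡⟨ node-check _ 2≤e ⟩
    nodeAt (#tree + (maxCheck ∸ (maxCheck ∸ (toℕ p ∸ #tree)))) ≡⟨ cong (λ q → nodeAt (#tree + q)) (m∸[m∸n]≡n q≤maxCheck) ⟩
    nodeAt (#tree + (toℕ p ∸ #tree))                         ≡⟨ cong nodeAt (m+[n∸m]≡n #tree≤p) ⟩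
    nodeAt (toℕ p)                                           ≡⟨ nodeAt-toℕ p ⟩
    inj₁ p                                                   ∎
    where
    open ≡-Reasoning
    q≤maxCheck : toℕ p ∸ #tree ≤ maxCheck
    q≤maxCheck = ≤-trans (<⇒≤ (p∸#tree<maxCheck∸1 (toℕ p) (toℕ<n p) #tree≤p)) (m∸n≤m maxCheck 1)

  codeAt-tree : ∀ p → p < #tree → codeAt p ≡ tree (suc p)
  codeAt-tree p p< with p <? #tree
  ... | yes _ = refl
  ... | no p≮ = ⊥-elim (p≮ p<)

  codeAt-check : ∀ p → #tree ≤ p → codeAt p ≡ check (maxCheck ∸ (p ∸ #tree))
  codeAt-check p #tree≤p with p <? #tree
  ... | yes p< = ⊥-elim (<⇒≱ p< #tree≤p)
  ... | no _ = refl

  code∘node-tree : ∀ i → 1 ≤ i → i < 2 ^ a → code (node (tree i)) ≡ tree i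
  code∘node-tree (suc i) _ i< = begin
    code (nodeAt i)               ≡⟨ cong code (nodeAt-< i i<#nodes) ⟩
    codeAt (toℕ (fromℕ< i<#nodes)) ≡⟨ cong codeAt (toℕ-fromℕ< i<#nodes) ⟩
    codeAt i                      ≡⟨ codeAt-tree i i<#tree ⟩
    tree (suc i)                  ∎
    where
    open ≡-Reasoning
    i<#tree : i < #tree
    i<#tree = <⇒≤∸1 i<
    i<#nodes : i < #nodes
    i<#nodes = <-≤-trans i<#tree (m≤m+n #tree _)

  code∘node-check : ∀ e → 1 ≤ e → e ≤ maxCheck → code (node (check e)) ≡ check e
  code∘node-check (suc zero) _ _ = refl
  code∘node-check e@(suc (suc _)) _ e≤ = begin
    code (nodeAt p)                ≡⟨ cong code (nodeAt-< p p<#nodes) ⟩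
    codeAt (toℕ (fromℕ< p<#nodes)) ≡⟨ cong codeAt (toℕ-fromℕ< p<#nodes) ⟩
    codeAt p                       ≡⟨ codeAt-check p (m≤m+n #tree _) ⟩
    check (maxCheck ∸ (p ∸ #tree)) ≡⟨ cong (λ q → check (maxCheck ∸ q)) (m+n∸m≡n #tree (maxCheck ∸ e)) ⟩
    check (maxCheck ∸ (maxCheck ∸ e)) ≡⟨ cong check (m∸[m∸n]≡n e≤) ⟩
    check e                        ∎
    where
    open ≡-Reasoning
    p = #tree + (maxCheck ∸ e)
    p<#nodes : p < #nodes
    p<#nodes = +-monoʳ-< #tree (∸-monoʳ-< {maxCheck} {e} {1} (s≤s (s≤s z≤n)) e≤)

  code∘node : ∀ c → InRange c → code (node c) ≡ c
  code∘node (tree i) (1≤i , i<) = code∘node-tree i 1≤i i<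
  code∘node (check e) (1≤e , e≤) = code∘node-check e 1≤e e≤
  code∘node reject _ = refl

  appendBits : Vec Bool m → ℕ → ℕ → ℕ → ℕ
  appendBits x zero i d = i
  appendBits x (suc r) i d = appendBits x r (2 * i + boolToℕ (bitAt x d)) (suc d)

  -- The check node of depth d from which t₁ is reachable on input x.
  checkTarget : Vec Bool m → ℕ → ℕ
  checkTarget x d = appendBits x d 1 a

  appendBits-suc : ∀ x r i d → appendBits x (suc r) i d ≡ 2 * appendBits x r i d + boolToℕ (bitAt x (d + r))
  appendBits-suc x zero i d = cong (λ j → 2 * i + boolToℕ (bitAt x j)) (sym (+-identityʳ d))
  appendBits-suc x (suc r) i d = trans (appendBits-suc x r (2 * i + boolToℕ (bitAt x d)) (suc d))
    (cong (λ j → 2 * appendBits x (suc r) i d + boolToℕ (bitAt x j)) (sym (+-suc d r)))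

  checkTarget-suc : ∀ x d → checkTarget x (suc d) ≡ 2 * checkTarget x d + boolToℕ (bitAt x (a + d))
  checkTarget-suc x d = appendBits-suc x d 1 a

  checkTarget-bounds : ∀ x d → 2 ^ d ≤ checkTarget x d × checkTarget x d < 2 ^ suc d
  checkTarget-bounds x zero = s≤s z≤n , s≤s (s≤s z≤n)
  checkTarget-bounds x (suc d) rewrite checkTarget-suc x d =
    ≤-trans (*-monoʳ-≤ 2 (proj₁ ih)) (m≤m+n _ _) , 2*y+c<2*N _ (proj₂ ih)
    where ih = checkTarget-bounds x d

  depth<a : ∀ j → 1 ≤ j → j < 2 ^ a → depth j < a
  depth<a j 1≤j j< = s≤s (2^m<2^[1+n]⇒m≤n (≤-<-trans (proj₁ (⌊log₂⌋-bounds j 1≤j)) j<))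

  depth-lastLevel : ∀ i c → i < 2 ^ a → 2 ^ a ≤ 2 * i + boolToℕ c → depth i ≡ a′
  depth-lastLevel i c i< 2^a≤ = ⌊log₂⌋-unique (≮⇒≥ λ i<2^a′ → <⇒≱ (2*y+c<2*N c i<2^a′) 2^a≤) i<

  depth-entry : ∀ e → 2 ^ b ≤ e → e ≤ maxCheck → depth e ≡ b
  depth-entry e 2^b≤e e≤ = ⌊log₂⌋-unique 2^b≤e (≤∸1⇒< (≤-trans (s≤s z≤n) 2≤2^[1+b]) e≤)

  varIndex-toℕ : ∀ j → j < m → toℕ (varIndex j) ≡ j
  varIndex-toℕ j j< with j <? m
  ... | yes _ = toℕ-fromℕ< _
  ... | no j≮ = ⊥-elim (j≮ j<)

  bitAt-tabulate : ∀ (w : ℕ → Bool) j → j < m → bitAt (tabulate (w ∘ toℕ)) j ≡ w j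
  bitAt-tabulate w j j< = trans (lookup∘tabulate (w ∘ toℕ) (varIndex j)) (cong w (varIndex-toℕ j j<))

  appendBits-binaryDigits : ∀ x r i d t → t < 2 ^ r → (∀ j → j < r → bitAt x (d + j) ≡ binaryDigit r t j) →
                            appendBits x r i d ≡ i * 2 ^ r + t
  appendBits-binaryDigits x zero i d zero _ _ = sym (trans (+-identityʳ (i * 1)) (*-identityʳ i))
  appendBits-binaryDigits x zero i d (suc t) (s≤s ()) _
  appendBits-binaryDigits x (suc r) i d t t< digits = begin
    appendBits x r (2 * i + boolToℕ (bitAt x d)) (suc d)          ≡⟨ appendBits-binaryDigits x r _ (suc d) _ (dropTopBit-< r t t<) digits′ ⟩
    (2 * i + boolToℕ (bitAt x d)) * 2 ^ r + dropTopBit r t         ≡⟨ cong (λ c → (2 * i + boolToℕ c) * 2 ^ r + dropTopBit r t) top ⟩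
    (2 * i + boolToℕ (does (2 ^ r ≤? t))) * 2 ^ r + dropTopBit r t ≡⟨ prependTopBit i r t (2 ^ r ≤? t) ⟩
    i * 2 ^ suc r + t                                              ∎
    where
    open ≡-Reasoning
    top : bitAt x d ≡ does (2 ^ r ≤? t)
    top = trans (cong (bitAt x) (sym (+-identityʳ d))) (digits 0 (s≤s z≤n))
    digits′ : ∀ j → j < r → bitAt x (suc d + j) ≡ binaryDigit r (dropTopBit r t) j
    digits′ j j< = trans (cong (bitAt x) (sym (+-suc d j))) (digits (suc j) (s≤s j<))

module Program (m′ a′ b : ℕ) (G : ℕ → ℕ → Bool) where
  open Layout m′ a′ b public

  arcCode : Code → Bool → Code → Bool
  arcCode (tree i) c (tree j) = j == 2 * i + boolToℕ c
  arcCode (tree i) c (check e) = (2 ^ a <= 2 * i + boolToℕ c) ∧ ((2 ^ b <= e) ∧ G (2 * i + boolToℕ c) e)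
  arcCode (check e) c (check e′) = e == 2 * e′ + boolToℕ c
  arcCode _ _ _ = false

  arc′ : Fin #nodes → Bool → Node #nodes → Bool
  arc′ u c v = arcCode (code (inj₁ u)) c (code v)

  acyclic′ : ∀ u c v → arc′ u c (inj₁ v) ≡ true → toℕ u < toℕ v
  acyclic′ u c v arc≡true
    with codeAt (toℕ u) | codeView (toℕ u) (toℕ<n u) | codeAt (toℕ v) | codeView (toℕ v) (toℕ<n v)
  ... | _ | isTree _ | _ | isTree _ = ≤-pred (begin
    suc (suc (toℕ u))              ≤⟨ s≤s (m≤n+m (suc (toℕ u)) (toℕ u)) ⟩
    suc (toℕ u) + suc (toℕ u)      ≡⟨ cong (suc (toℕ u) +_) (sym (+-identityʳ _)) ⟩
    2 * suc (toℕ u)                ≤⟨ m≤m+n _ _ ⟩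
    2 * suc (toℕ u) + boolToℕ c    ≡⟨ sym (==-sound arc≡true) ⟩
    suc (toℕ v)                    ∎)
    where open ≤-Reasoning
  ... | _ | isTree u<#tree | _ | isCheck #tree≤v _ = <-≤-trans u<#tree #tree≤v
  ... | _ | isCheck _ _ | _ | isTree _ = ⊥-elim (false≢true arc≡true)
    where
    false≢true : false ≢ true
    false≢true ()
  ... | _ | isCheck #tree≤u _ | _ | isCheck #tree≤v 2≤ev =
    subst₂ _<_ (m∸n+n≡m #tree≤u) (m∸n+n≡m #tree≤v) (+-monoˡ-< #tree (∸-cancelʳ-< {o = maxCheck} ev<eu))
    where
    ev = maxCheck ∸ (toℕ v ∸ #tree)
    ev<eu : ev < maxCheck ∸ (toℕ u ∸ #tree)
    ev<eu = begin-strict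
      ev                    <⟨ m<m+n ev (≤-trans (s≤s z≤n) 2≤ev) ⟩
      ev + ev               ≡⟨ cong (ev +_) (sym (+-identityʳ ev)) ⟩
      2 * ev                ≤⟨ m≤m+n _ _ ⟩
      2 * ev + boolToℕ c    ≡⟨ sym (==-sound arc≡true) ⟩
      maxCheck ∸ (toℕ u ∸ #tree) ∎
      where open ≤-Reasoning

  prog : BP m #nodes
  prog = record
    { start = node (tree 1)
    ; label = λ p → varIndex (varOf (code (inj₁ p)))
    ; arc = arc′
    ; acyclic = acyclic′
    }

  pathCount : Vec Bool m → ℕ → Code → ℕ
  pathCount x ℓ (tree i) =
    if ℓ == (a ∸ depth i) + b then boolToℕ (G (appendBits x (a ∸ depth i) i (depth i)) (checkTarget x b)) else 0
  pathCount x ℓ (check e) = if (ℓ == depth e) ∧ (e == checkTarget x (depth e)) then 1 else 0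
  pathCount x ℓ reject = 0

  contribution : Vec Bool m → ℕ → Code → Bool → Code → ℕ
  contribution x ℓ cu c cv = if arcCode cu c cv then pathCount x ℓ cv else 0

  sum-contribution-single : ∀ x ℓ cu c tc → InRange tc →
    (∀ cv → InRange cv → cv ≢ tc → contribution x ℓ cu c cv ≡ 0) →
    sum (map (contribution x ℓ cu c ∘ code) (allNodes #nodes)) ≡ contribution x ℓ cu c tc
  sum-contribution-single x ℓ cu c tc tc-inRange vanish =
    trans (sum-allNodes-single _ (node tc) λ v v≢ →
             vanish (code v) (code-inRange v) λ e → v≢ (trans (sym (node∘code v)) (cong node e)))
          (cong (contribution x ℓ cu c) (code∘node tc tc-inRange))

  innerStep-others : ∀ x ℓ i c → 2 * i + boolToℕ c < 2 ^ a →
    ∀ cv → InRange cv → cv ≢ tree (2 * i + boolToℕ c) → contribution x ℓ (tree i) c cv ≡ 0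
  innerStep-others x ℓ i c _ (tree j) _ cv≢ rewrite ==-false {j} {2 * i + boolToℕ c} (cv≢ ∘ cong tree) = refl
  innerStep-others x ℓ i c j< (check e) _ _ rewrite <=-false (<⇒≱ j<) = refl
  innerStep-others x ℓ i c _ reject _ _ = refl

  innerStep : ∀ x ℓ i → 1 ≤ i → i < 2 ^ a → 2 * i + boolToℕ (bitAt x (depth i)) < 2 ^ a →
    sum (map (contribution x ℓ (tree i) (bitAt x (depth i)) ∘ code) (allNodes #nodes)) ≡ pathCount x (suc ℓ) (tree i)
  innerStep x ℓ i 1≤i i< j< = begin
    sum (map (contribution x ℓ (tree i) c ∘ code) (allNodes #nodes))
      ≡⟨ sum-contribution-single x ℓ (tree i) c (tree j) (1≤j , j<) (innerStep-others x ℓ i c j<) ⟩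
    contribution x ℓ (tree i) c (tree j)
      ≡⟨ cong (λ arc → if arc then pathCount x ℓ (tree j) else 0) (==-true {j} refl) ⟩
    pathCount x ℓ (tree j)
      ≡⟨ one-level-down ⟩
    pathCount x (suc ℓ) (tree i) ∎
    where
    open ≡-Reasoning
    c = bitAt x (depth i)
    j = 2 * i + boolToℕ c
    1≤j : 1 ≤ j
    1≤j = ≤-trans (≤-trans 1≤i (m≤m+n i _)) (m≤m+n _ _)
    depth-j : depth j ≡ suc (depth i)
    depth-j = depth-child i c 1≤i
    a∸depth-i : a ∸ depth i ≡ suc (a ∸ depth j)
    a∸depth-i = trans (+-∸-assoc 1 (depth<a i 1≤i i<)) (cong (λ d → suc (a ∸ d)) (sym depth-j))
    one-level-down : pathCount x ℓ (tree j) ≡ pathCount x (suc ℓ) (tree i)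
    one-level-down rewrite a∸depth-i | ==-suc ℓ ((a ∸ depth j) + b) | depth-j = refl

  leafStep-others : ∀ x ℓ i c → 2 ^ a ≤ 2 * i + boolToℕ c →
    ∀ cv → InRange cv → cv ≢ check (checkTarget x b) → contribution x ℓ (tree i) c cv ≡ 0
  leafStep-others x ℓ i c 2^a≤j (tree j′) (_ , j′<) _ with j′ ≟ 2 * i + boolToℕ c
  ... | yes refl = ⊥-elim (<⇒≱ j′< 2^a≤j)
  ... | no j′≢j rewrite ==-false j′≢j = refl
  leafStep-others x ℓ i c 2^a≤j (check e) (_ , e≤) cv≢ rewrite <=-true 2^a≤j with 2 ^ b ≤? e
  ... | no 2^b≰e rewrite <=-false 2^b≰e = refl
  ... | yes 2^b≤e rewrite <=-true 2^b≤e with G (2 * i + boolToℕ c) e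
  ...   | false = refl
  ...   | true rewrite depth-entry e 2^b≤e e≤ | ==-false {e} {checkTarget x b} (cv≢ ∘ cong check)
                     | ∧-zeroʳ (ℓ == b) = refl
  leafStep-others x ℓ i c _ reject _ _ = refl

  leafStep : ∀ x ℓ i → 1 ≤ i → i < 2 ^ a → 2 ^ a ≤ 2 * i + boolToℕ (bitAt x (depth i)) →
    sum (map (contribution x ℓ (tree i) (bitAt x (depth i)) ∘ code) (allNodes #nodes)) ≡ pathCount x (suc ℓ) (tree i)
  leafStep x ℓ i 1≤i i< 2^a≤j = begin
    sum (map (contribution x ℓ (tree i) c ∘ code) (allNodes #nodes))
      ≡⟨ sum-contribution-single x ℓ (tree i) c (check t) (≤-trans (m^n>0 2 b) 2^b≤t , <⇒≤∸1 t<) (leafStep-others x ℓ i c 2^a≤j) ⟩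
    contribution x ℓ (tree i) c (check t)
      ≡⟨ arc-to-target ⟩
    (if G j t then (if ℓ == b then 1 else 0) else 0)
      ≡⟨ if-indicator-swap (G j t) (ℓ == b) ⟩
    (if ℓ == b then boolToℕ (G j t) else 0)
      ≡⟨ last-level ⟩
    pathCount x (suc ℓ) (tree i) ∎
    where
    open ≡-Reasoning
    c = bitAt x (depth i)
    j = 2 * i + boolToℕ c
    t = checkTarget x b
    2^b≤t = proj₁ (checkTarget-bounds x b)
    t< = proj₂ (checkTarget-bounds x b)
    arc-to-target : contribution x ℓ (tree i) c (check t) ≡ (if G j t then (if ℓ == b then 1 else 0) else 0)
    arc-to-target rewrite <=-true 2^a≤j | <=-true 2^b≤t | depth-entry t 2^b≤t (<⇒≤∸1 t<)
                        | ==-true {t} refl | ∧-identityʳ (ℓ == b) = refl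
    last-level : (if ℓ == b then boolToℕ (G j t) else 0) ≡ pathCount x (suc ℓ) (tree i)
    last-level rewrite depth-lastLevel i c i< 2^a≤j | m+n∸n≡m 1 a′ | ==-suc ℓ b = refl

  checkStep-others : ∀ x ℓ e c → ∀ cv → InRange cv → cv ≢ check ⌊ e /2⌋ → contribution x ℓ (check e) c cv ≡ 0
  checkStep-others x ℓ e c (tree _) _ _ = refl
  checkStep-others x ℓ e c (check e′) _ cv≢ with e ≟ 2 * e′ + boolToℕ c
  ... | yes e≡ = ⊥-elim (cv≢ (cong check (sym (trans (cong ⌊_/2⌋ e≡) (⌊2*y+c/2⌋≡y e′ c)))))
  ... | no e≢ rewrite ==-false e≢ = refl
  checkStep-others x ℓ e c reject _ _ = refl

  checkStep : ∀ x ℓ e → 2 ≤ e → e ≤ maxCheck →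
    sum (map (contribution x ℓ (check e) (bitAt x (a′ + depth e)) ∘ code) (allNodes #nodes)) ≡ pathCount x (suc ℓ) (check e)
  checkStep x ℓ e 2≤e e≤ = begin
    sum (map (contribution x ℓ (check e) c ∘ code) (allNodes #nodes))
      ≡⟨ sum-contribution-single x ℓ (check e) c (check h) (⌊n/2⌋-mono 2≤e , ≤-trans (⌊n/2⌋≤n e) e≤) (checkStep-others x ℓ e c) ⟩
    contribution x ℓ (check e) c (check h)
      ≡⟨ cong (λ d → if e == 2 * h + boolToℕ c then (if (ℓ == d) ∧ (h == checkTarget x d) then 1 else 0) else 0) depth-h ⟩
    (if e == 2 * h + boolToℕ c then (if (ℓ == d) ∧ (h == checkTarget x d) then 1 else 0) else 0)
      ≡⟨ if-indicator-∧ (e == 2 * h + boolToℕ c) (ℓ == d) (h == checkTarget x d) ⟩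
    (if (ℓ == d) ∧ ((e == 2 * h + boolToℕ c) ∧ (h == checkTarget x d)) then 1 else 0)
      ≡⟨ cong (λ q → if (ℓ == d) ∧ q then 1 else 0) (==-halve e (checkTarget x d) c) ⟩
    (if (ℓ == d) ∧ (e == 2 * checkTarget x d + boolToℕ c) then 1 else 0)
      ≡⟨ one-level-up ⟩
    pathCount x (suc ℓ) (check e) ∎
    where
    open ≡-Reasoning
    c = bitAt x (a′ + depth e)
    h = ⌊ e /2⌋
    d = depth e ∸ 1
    depth-h : depth h ≡ d
    depth-h = ⌊log₂⌊n/2⌋⌋≡⌊log₂n⌋∸1 e
    depth-e : depth e ≡ suc d
    depth-e = sym (trans (+-comm 1 d) (m∸n+n≡m (1≤depth e 2≤e)))
    one-level-up : (if (ℓ == d) ∧ (e == 2 * checkTarget x d + boolToℕ c) then 1 else 0) ≡ pathCount x (suc ℓ) (check e)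
    one-level-up rewrite depth-e | ==-suc ℓ d | checkTarget-suc x d | +-suc a′ d = refl

  0≢[a∸d]+b : ∀ {d} → d < a → 0 ≢ (a ∸ d) + b
  0≢[a∸d]+b d<a 0≡ = 0≢1+n (trans 0≡ (cong (_+ b) (+-∸-assoc 1 d<a)))

  pathCount-zero : ∀ x p → pathCount x 0 (code (inj₁ p)) ≡ 0
  pathCount-zero x p with codeAt (toℕ p) | codeView (toℕ p) (toℕ<n p)
  ... | _ | isTree p< rewrite ==-false (0≢[a∸d]+b (depth<a (suc (toℕ p)) (s≤s z≤n) (suc-<2^a p<))) = refl
  ... | _ | isCheck _ 2≤e rewrite ==-false {0} {depth (maxCheck ∸ (toℕ p ∸ #tree))} (<⇒≢ (1≤depth _ 2≤e)) = refl

  pathsLen≡pathCount : ∀ x ℓ v → pathsLen prog x ℓ v ≡ pathCount x ℓ (code v)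
  pathsLen≡pathCount x zero (inj₂ true) rewrite ==-true {0} refl | ==-true {1} refl = refl
  pathsLen≡pathCount x zero (inj₂ false) = refl
  pathsLen≡pathCount x zero (inj₁ p) = sym (pathCount-zero x p)
  pathsLen≡pathCount x (suc ℓ) (inj₂ true) rewrite ==-false {suc ℓ} {0} (λ ()) = refl
  pathsLen≡pathCount x (suc ℓ) (inj₂ false) = refl
  pathsLen≡pathCount x (suc ℓ) (inj₁ p) =
    trans (cong sum (map-cong (λ v → cong (λ n → if arc′ p c v then n else 0) (pathsLen≡pathCount x ℓ v)) (allNodes #nodes)))
          (step (codeAt (toℕ p)) (codeView (toℕ p) (toℕ<n p)))
    where
    c = bitAt x (varOf (code (inj₁ p)))
    step : ∀ cu → CodeView (toℕ p) cu →
           sum (map (contribution x ℓ cu (bitAt x (varOf cu)) ∘ code) (allNodes #nodes)) ≡ pathCount x (suc ℓ) cu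
    step _ (isTree p<) with 2 ^ a ≤? 2 * suc (toℕ p) + boolToℕ (bitAt x (depth (suc (toℕ p))))
    ... | yes 2^a≤j = leafStep x ℓ (suc (toℕ p)) (s≤s z≤n) (suc-<2^a p<) 2^a≤j
    ... | no 2^a≰j = innerStep x ℓ (suc (toℕ p)) (s≤s z≤n) (suc-<2^a p<) (≰⇒> 2^a≰j)
    step _ (isCheck _ 2≤e) = checkStep x ℓ _ 2≤e (m∸n≤m maxCheck (toℕ p ∸ #tree))

  computed : Vec Bool m → Bool
  computed x = G (appendBits x a 1 0) (checkTarget x b)

  pathCount-start : ∀ x ℓ → pathCount x ℓ (code (node (tree 1))) ≡ (if ℓ == a + b then boolToℕ (computed x) else 0)
  pathCount-start x ℓ rewrite code∘node-tree 1 (s≤s z≤n) 2≤2^a = refl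

  a+b<1+#nodes : a + b < suc #nodes
  a+b<1+#nodes = s≤s (+-mono-≤ (<⇒≤∸1 (n<2^n a)) b≤maxCheck∸1)
    where
    b≤maxCheck∸1 : b ≤ maxCheck ∸ 1
    b≤maxCheck∸1 = begin
      b                     ≡⟨ sym (m+n∸n≡m b 2) ⟩
      b + 2 ∸ 2             ≤⟨ ∸-monoˡ-≤ 2 (subst (_≤ 2 ^ suc b) (+-comm 2 b) (n<2^n (suc b))) ⟩
      2 ^ suc b ∸ 2         ≡⟨ sym (∸-+-assoc (2 ^ suc b) 1 1) ⟩
      maxCheck ∸ 1          ∎
      where open ≤-Reasoning

  numPaths-prog : ∀ x → numPaths prog x ≡ boolToℕ (computed x)
  numPaths-prog x = begin
    sum (map (λ ℓ → pathsLen prog x ℓ (node (tree 1))) (upTo (suc #nodes)))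
      ≡⟨ cong sum (map-cong (λ ℓ → trans (pathsLen≡pathCount x ℓ _) (pathCount-start x ℓ)) (upTo (suc #nodes))) ⟩
    sum (map atLength (upTo (suc #nodes)))
      ≡⟨ sum-map-single atLength (Unique.upTo⁺ (suc #nodes)) (∈-upTo⁺ a+b<1+#nodes) otherLengths ⟩
    atLength (a + b)
      ≡⟨ cong (λ q → if q then boolToℕ (computed x) else 0) (==-true {a + b} refl) ⟩
    boolToℕ (computed x) ∎
    where
    open ≡-Reasoning
    atLength : ℕ → ℕ
    atLength ℓ = if ℓ == a + b then boolToℕ (computed x) else 0
    otherLengths : ∀ ℓ → ℓ ≢ a + b → atLength ℓ ≡ 0
    otherLengths ℓ ℓ≢ rewrite ==-false ℓ≢ = refl

  prog-computes : ∀ M x → accepts M prog x ≡ computed x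
  prog-computes NBP x rewrite numPaths-prog x with computed x
  ... | true = refl
  ... | false = refl
  prog-computes ParityBP x rewrite numPaths-prog x with computed x
  ... | true = refl
  ... | false = refl

lookupℕ : ∀ {N} → ℕ → Vec Bool N → Bool
lookupℕ q [] = false
lookupℕ zero (x ∷ _) = x
lookupℕ (suc q) (_ ∷ v) = lookupℕ q v

lookupℕ-extensional : ∀ {N} (v w : Vec Bool N) → (∀ q → q < N → lookupℕ q v ≡ lookupℕ q w) → v ≡ w
lookupℕ-extensional [] [] _ = refl
lookupℕ-extensional (x ∷ v) (y ∷ w) agree =
  cong₂ _∷_ (agree 0 (s≤s z≤n)) (lookupℕ-extensional v w λ q q< → agree (suc q) (s≤s q<))

allVecs-unique : ∀ n → Unique (allVecs n)
allVecs-unique zero = [] ∷ []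
allVecs-unique (suc n) = Unique.++⁺ (Unique.map⁺ ∷-injectiveʳ (allVecs-unique n))
                                    (Unique.map⁺ ∷-injectiveʳ (allVecs-unique n)) disjoint
  where
  disjoint : ∀ {v} → v ∈ map (false ∷_) (allVecs n) × v ∈ map (true ∷_) (allVecs n) → ⊥
  disjoint (v∈ , v∈′) with ∈-map⁻ (false ∷_) v∈ | ∈-map⁻ (true ∷_) v∈′
  ... | _ , _ , refl | _ , _ , ()

module Family (m′ a′ b : ℕ) (a+b≤m : suc a′ + b ≤ suc m′) where
  open Layout m′ a′ b public

  #entries = 2 ^ a * 2 ^ b

  tableFunction : Vec Bool #entries → ℕ → ℕ → Bool
  tableFunction tb i e = lookupℕ ((i ∸ 2 ^ a) * 2 ^ b + (e ∸ 2 ^ b)) tb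

  family : Vec Bool #entries → BoolFun m
  family tb = Program.computed m′ a′ b (tableFunction tb)

  inputBitsBy : ℕ → ℕ → (j : ℕ) → Dec (j < a) → Bool
  inputBitsBy u w j (yes _) = binaryDigit a u j
  inputBitsBy u w j (no _) = binaryDigit b w (j ∸ a)

  input : ℕ → ℕ → Vec Bool m
  input u w = tabulate (λ k → inputBitsBy u w (toℕ k) (toℕ k <? a))

  appendBits-input : ∀ u w → u < 2 ^ a → appendBits (input u w) a 1 0 ≡ 1 * 2 ^ a + u
  appendBits-input u w u< = appendBits-binaryDigits (input u w) a 1 0 u u< digits
    where
    digits : ∀ j → j < a → bitAt (input u w) j ≡ binaryDigit a u j
    digits j j<a = trans (bitAt-tabulate (λ j → inputBitsBy u w j (j <? a)) j (≤-trans j<a (≤-trans (m≤m+n a b) a+b≤m)))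
                         (first (j <? a))
      where
      first : (j<a? : Dec (j < a)) → inputBitsBy u w j j<a? ≡ binaryDigit a u j
      first (yes _) = refl
      first (no j≮a) = ⊥-elim (j≮a j<a)

  checkTarget-input : ∀ u w → w < 2 ^ b → checkTarget (input u w) b ≡ 1 * 2 ^ b + w
  checkTarget-input u w w< = appendBits-binaryDigits (input u w) b 1 a w w< digits
    where
    digits : ∀ j → j < b → bitAt (input u w) (a + j) ≡ binaryDigit b w j
    digits j j<b = trans (bitAt-tabulate (λ j → inputBitsBy u w j (j <? a)) (a + j) (≤-trans (+-monoʳ-< a j<b) a+b≤m))
                         (second ((a + j) <? a))
      where
      second : (a+j<a? : Dec (a + j < a)) → inputBitsBy u w (a + j) a+j<a? ≡ binaryDigit b w j
      second (yes a+j<a) = ⊥-elim (<⇒≱ a+j<a (m≤m+n a j))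
      second (no _) = cong (binaryDigit b w) (m+n∸m≡n a j)

  family-input : ∀ tb u w → u < 2 ^ a → w < 2 ^ b → family tb (input u w) ≡ lookupℕ (u * 2 ^ b + w) tb
  family-input tb u w u< w< rewrite appendBits-input u w u< | checkTarget-input u w w<
                                  | *-identityˡ (2 ^ a) | *-identityˡ (2 ^ b)
                                  | m+n∸m≡n (2 ^ a) u | m+n∸m≡n (2 ^ b) w = refl

  family-distinct : ∀ tb tb′ → tb ≢ tb′ → Distinct (family tb) (family tb′)
  family-distinct tb tb′ tb≢tb′ same = tb≢tb′ (lookupℕ-extensional tb tb′ agree)
    where
    agree : ∀ q → q < #entries → lookupℕ q tb ≡ lookupℕ q tb′
    agree q q< = begin
      lookupℕ q tb                       ≡⟨ cong (λ q → lookupℕ q tb) (sym q≡) ⟩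
      lookupℕ (u * 2 ^ b + w) tb         ≡⟨ sym (family-input tb u w u< w<) ⟩
      family tb (input u w)              ≡⟨ same (input u w) ⟩
      family tb′ (input u w)             ≡⟨ family-input tb′ u w u< w< ⟩
      lookupℕ (u * 2 ^ b + w) tb′        ≡⟨ cong (λ q → lookupℕ q tb′) q≡ ⟩
      lookupℕ q tb′                      ∎
      where
      open ≡-Reasoning
      instance
        2^b≢0 : NonZero (2 ^ b)
        2^b≢0 = m^n≢0 2 b
      u = q / 2 ^ b
      w = q % 2 ^ b
      u< : u < 2 ^ a
      u< = m<n*o⇒m/o<n q<
      w< : w < 2 ^ b
      w< = m%n<n q (2 ^ b)
      q≡ : u * 2 ^ b + w ≡ q
      q≡ = trans (+-comm _ w) (sym (m≡m%n+[m/n]*n q (2 ^ b)))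

  MsemAtLeast-family : ∀ M S r → #nodes ≤ S → r ≤ 2 ^ #entries → MsemAtLeast M m S r
  MsemAtLeast-family M S r #nodes≤S r≤ =
    map family (allVecs #entries) ,
    ≤-trans r≤ (≤-reflexive (sym (trans (length-map family (allVecs #entries)) (length-allVecs #entries)))) ,
    AllPairs.map⁺ (AllPairs.map (family-distinct _ _) (allVecs-unique #entries)) ,
    All.map⁺ (All.tabulate λ {tb} _ →
      #nodes , #nodes≤S , Program.prog m′ a′ b (tableFunction tb) , Program.prog-computes m′ a′ b (tableFunction tb) M)

1+d≤2*2^⌊d/2⌋ : ∀ d → suc d ≤ 2 * 2 ^ ⌊ d /2⌋
1+d≤2*2^⌊d/2⌋ zero = s≤s z≤n
1+d≤2*2^⌊d/2⌋ (suc zero) = s≤s (s≤s z≤n)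
1+d≤2*2^⌊d/2⌋ (suc (suc zero)) = s≤s (s≤s (s≤s z≤n))
1+d≤2*2^⌊d/2⌋ (suc (suc (suc d))) = begin
  4 + d                    ≤⟨ m≤m+n (4 + d) d ⟩
  4 + d + d                ≡⟨ double d ⟩
  2 * (2 + d)              ≤⟨ *-monoʳ-≤ 2 (1+d≤2*2^⌊d/2⌋ (suc d)) ⟩
  2 * (2 * 2 ^ ⌊ suc d /2⌋) ∎
  where
  open ≤-Reasoning
  double : ∀ d → 4 + d + d ≡ 2 * (2 + d)
  double = solve-∀

⌈m/2⌉+⌊d/2⌋≤⌈m+d/2⌉ : ∀ m d → ⌈ m /2⌉ + ⌊ d /2⌋ ≤ ⌈ m + d /2⌉
⌈m/2⌉+⌊d/2⌋≤⌈m+d/2⌉ m zero = ≤-reflexive (trans (+-identityʳ _) (cong ⌈_/2⌉ (sym (+-identityʳ m))))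
⌈m/2⌉+⌊d/2⌋≤⌈m+d/2⌉ m (suc zero) = ≤-trans (≤-reflexive (+-identityʳ _)) (⌈n/2⌉-mono (≤-trans (n≤1+n m) (≤-reflexive (+-comm 1 m))))
⌈m/2⌉+⌊d/2⌋≤⌈m+d/2⌉ m (suc (suc d)) = begin
  ⌈ m /2⌉ + suc ⌊ d /2⌋      ≡⟨ +-suc ⌈ m /2⌉ ⌊ d /2⌋ ⟩
  suc (⌈ m /2⌉ + ⌊ d /2⌋)    ≤⟨ s≤s (⌈m/2⌉+⌊d/2⌋≤⌈m+d/2⌉ m d) ⟩
  suc ⌈ m + d /2⌉            ≡⟨ cong ⌈_/2⌉ (sym (trans (+-suc m (suc d)) (cong suc (+-suc m d)))) ⟩
  ⌈ m + suc (suc d) /2⌉      ∎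
  where open ≤-Reasoning

⌈n/2⌉≤1+⌊n/2⌋ : ∀ n → ⌈ n /2⌉ ≤ suc ⌊ n /2⌋
⌈n/2⌉≤1+⌊n/2⌋ zero = z≤n
⌈n/2⌉≤1+⌊n/2⌋ (suc zero) = s≤s z≤n
⌈n/2⌉≤1+⌊n/2⌋ (suc (suc n)) = s≤s (⌈n/2⌉≤1+⌊n/2⌋ n)

ℓ≤2*2^⌈ℓ/2⌉ : ∀ ℓ → ℓ ≤ 2 * 2 ^ ⌈ ℓ /2⌉
ℓ≤2*2^⌈ℓ/2⌉ ℓ = ≤-trans (n≤1+n ℓ) (≤-trans (1+d≤2*2^⌊d/2⌋ ℓ) (*-monoʳ-≤ 2 (^-monoʳ-≤ 2 (⌊n/2⌋≤⌈n/2⌉ ℓ))))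

2^⌈ℓ/2⌉*2^⌈ℓ/2⌉≤2*2^ℓ : ∀ ℓ → 2 ^ ⌈ ℓ /2⌉ * 2 ^ ⌈ ℓ /2⌉ ≤ 2 * 2 ^ ℓ
2^⌈ℓ/2⌉*2^⌈ℓ/2⌉≤2*2^ℓ ℓ = begin
  2 ^ ⌈ ℓ /2⌉ * 2 ^ ⌈ ℓ /2⌉   ≡⟨ sym (^-distribˡ-+-* 2 ⌈ ℓ /2⌉ ⌈ ℓ /2⌉) ⟩
  2 ^ (⌈ ℓ /2⌉ + ⌈ ℓ /2⌉)     ≤⟨ ^-monoʳ-≤ 2 (+-monoˡ-≤ ⌈ ℓ /2⌉ (⌈n/2⌉≤1+⌊n/2⌋ ℓ)) ⟩
  2 ^ suc (⌊ ℓ /2⌋ + ⌈ ℓ /2⌉) ≡⟨ cong (λ e → 2 ^ suc e) (⌊n/2⌋+⌈n/2⌉≡n ℓ) ⟩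
  2 * 2 ^ ℓ                   ∎
  where open ≤-Reasoning

-- If s ≤ ℓ, the factor ℓ = s + (ℓ ∸ s) ≤ s · 2 · 2^⌊(ℓ ∸ s)/2⌋ is absorbed into 2^⌈ℓ/2⌉; otherwise ℓ < s.
ℓ*2^⌈s⊓[1+ℓ]/2⌉≤2*2^⌈ℓ/2⌉*s : ∀ ℓ s → 1 ≤ s → ℓ * 2 ^ ⌈ s ⊓ suc ℓ /2⌉ ≤ 2 * (2 ^ ⌈ ℓ /2⌉ * s)
ℓ*2^⌈s⊓[1+ℓ]/2⌉≤2*2^⌈ℓ/2⌉*s ℓ s 1≤s with s ≤? ℓ
... | yes s≤ℓ rewrite m≤n⇒m⊓n≡m (≤-trans s≤ℓ (n≤1+n ℓ)) = begin
  ℓ * 2 ^ ⌈ s /2⌉                              ≡⟨ cong (_* 2 ^ ⌈ s /2⌉) (sym (m+[n∸m]≡n s≤ℓ)) ⟩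
  (s + d) * 2 ^ ⌈ s /2⌉                        ≤⟨ *-monoˡ-≤ (2 ^ ⌈ s /2⌉) (+-monoʳ-≤ s (m≤n*m d s {{>-nonZero 1≤s}})) ⟩
  (s + s * d) * 2 ^ ⌈ s /2⌉                    ≡⟨ cong (_* 2 ^ ⌈ s /2⌉) (sym (*-suc s d)) ⟩
  s * suc d * 2 ^ ⌈ s /2⌉                      ≤⟨ *-monoˡ-≤ (2 ^ ⌈ s /2⌉) (*-monoʳ-≤ s (1+d≤2*2^⌊d/2⌋ d)) ⟩
  s * (2 * 2 ^ ⌊ d /2⌋) * 2 ^ ⌈ s /2⌉          ≡⟨ regroup s (2 ^ ⌊ d /2⌋) (2 ^ ⌈ s /2⌉) ⟩
  2 * (2 ^ ⌈ s /2⌉ * 2 ^ ⌊ d /2⌋ * s)          ≡⟨ cong (λ z → 2 * (z * s)) (sym (^-distribˡ-+-* 2 ⌈ s /2⌉ ⌊ d /2⌋)) ⟩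
  2 * (2 ^ (⌈ s /2⌉ + ⌊ d /2⌋) * s)            ≤⟨ *-monoʳ-≤ 2 (*-monoˡ-≤ s (^-monoʳ-≤ 2 exponent≤)) ⟩
  2 * (2 ^ ⌈ ℓ /2⌉ * s)                        ∎
  where
  open ≤-Reasoning
  d = ℓ ∸ s
  exponent≤ : ⌈ s /2⌉ + ⌊ d /2⌋ ≤ ⌈ ℓ /2⌉
  exponent≤ = ≤-trans (⌈m/2⌉+⌊d/2⌋≤⌈m+d/2⌉ s d) (≤-reflexive (cong ⌈_/2⌉ (m+[n∸m]≡n s≤ℓ)))
  regroup : ∀ x y z → x * (2 * y) * z ≡ 2 * (z * y * x)
  regroup = solve-∀
... | no s≰ℓ rewrite m≥n⇒m⊓n≡n (≰⇒> s≰ℓ) = begin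
  ℓ * 2 ^ ⌈ suc ℓ /2⌉        ≤⟨ *-monoʳ-≤ ℓ (^-monoʳ-≤ 2 (s≤s (⌊n/2⌋≤⌈n/2⌉ ℓ))) ⟩
  ℓ * (2 * 2 ^ ⌈ ℓ /2⌉)      ≤⟨ *-monoˡ-≤ (2 * 2 ^ ⌈ ℓ /2⌉) (≤-trans (n≤1+n ℓ) (≰⇒> s≰ℓ)) ⟩
  s * (2 * 2 ^ ⌈ ℓ /2⌉)      ≡⟨ regroup s (2 ^ ⌈ ℓ /2⌉) ⟩
  2 * (2 ^ ⌈ ℓ /2⌉ * s)      ∎
  where
  open ≤-Reasoning
  regroup : ∀ x y → x * (2 * y) ≡ 2 * (y * x)
  regroup = solve-∀

blockCost≤ : ∀ ℓ s → 1 ≤ s → ℓ * (s + 3 * 2 ^ ⌈ s ⊓ suc ℓ /2⌉) ≤ 8 * (2 ^ ⌈ ℓ /2⌉ * s)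
blockCost≤ ℓ s 1≤s = begin
  ℓ * (s + 3 * P)                      ≡⟨ distribute ℓ s P ⟩
  ℓ * s + 3 * (ℓ * P)                  ≤⟨ +-mono-≤ (*-monoˡ-≤ s (ℓ≤2*2^⌈ℓ/2⌉ ℓ)) (*-monoʳ-≤ 3 (ℓ*2^⌈s⊓[1+ℓ]/2⌉≤2*2^⌈ℓ/2⌉*s ℓ s 1≤s)) ⟩
  2 * Q * s + 3 * (2 * (Q * s))        ≡⟨ collect Q s ⟩
  8 * (Q * s)                          ∎
  where
  open ≤-Reasoning
  P = 2 ^ ⌈ s ⊓ suc ℓ /2⌉
  Q = 2 ^ ⌈ ℓ /2⌉
  distribute : ∀ l m p → l * (m + 3 * p) ≡ l * m + 3 * (l * p)
  distribute = solve-∀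
  collect : ∀ q m → 2 * q * m + 3 * (2 * (q * m)) ≡ 8 * (q * m)
  collect = solve-∀

sumFin-blockCost≤ : ∀ {n p} (π : Fin n → Fin p) → Surj π → ∀ ℓ →
  ℓ * sumFin p (λ i → blockSize π i + 3 * 2 ^ ⌈ blockSize π i ⊓ suc ℓ /2⌉) ≤ 8 * (2 ^ ⌈ ℓ /2⌉ * n)
sumFin-blockCost≤ {n} {p} π surj ℓ = begin
  ℓ * sumFin p cost                       ≡⟨ sym (sumFin-*ˡ p ℓ cost) ⟩
  sumFin p (λ i → ℓ * cost i)             ≤⟨ sumFin-mono-≤ p (λ i → blockCost≤ ℓ (blockSize π i) (Surj⇒1≤blockSize π surj i)) ⟩
  sumFin p (λ i → 8 * (Q * blockSize π i)) ≡⟨ sumFin-*ˡ p 8 (λ i → Q * blockSize π i) ⟩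
  8 * sumFin p (λ i → Q * blockSize π i)  ≡⟨ cong (8 *_) (sumFin-*ˡ p Q (blockSize π)) ⟩
  8 * (Q * sumFin p (blockSize π))        ≡⟨ cong (λ s → 8 * (Q * s)) (sumFin-blockSize n p π) ⟩
  8 * (Q * n)                             ∎
  where
  open ≤-Reasoning
  Q = 2 ^ ⌈ ℓ /2⌉
  cost : Fin p → ℕ
  cost i = blockSize π i + 3 * 2 ^ ⌈ blockSize π i ⊓ suc ℓ /2⌉

MsemAtLeast-2^2^k : ∀ M s k → 1 ≤ k → k ≤ s → ∀ r → r ≤ 2 ^ 2 ^ k → MsemAtLeast M s (3 * 2 ^ ⌈ k /2⌉) r
MsemAtLeast-2^2^k M zero k 1≤k k≤0 with ≤-trans 1≤k k≤0
... | ()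
MsemAtLeast-2^2^k M (suc m′) k 1≤k k≤s r r≤ with ⌈ k /2⌉ in ⌈k/2⌉≡
... | zero = ⊥-elim (<⇒≱ (⌈n/2⌉-mono 1≤k) (≤-reflexive ⌈k/2⌉≡))
... | suc a′ = MsemAtLeast-family M (3 * 2 ^ suc a′) r #nodes≤ (subst (λ e → r ≤ 2 ^ e) 2^k≡ r≤)
  where
  b = ⌊ k /2⌋
  a+b≡k : suc a′ + b ≡ k
  a+b≡k = trans (cong (_+ b) (sym ⌈k/2⌉≡)) (trans (+-comm ⌈ k /2⌉ b) (⌊n/2⌋+⌈n/2⌉≡n k))
  open Family m′ a′ b (subst (_≤ suc m′) (sym a+b≡k) k≤s)
  2^k≡ : 2 ^ k ≡ 2 ^ suc a′ * 2 ^ b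
  2^k≡ = trans (cong (2 ^_) (sym a+b≡k)) (^-distribˡ-+-* 2 (suc a′) b)
  #nodes≤ : #nodes ≤ 3 * 2 ^ suc a′
  #nodes≤ = begin
    (2 ^ a ∸ 1) + (2 ^ suc b ∸ 1 ∸ 1) ≤⟨ +-mono-≤ (m∸n≤m (2 ^ a) 1) (≤-trans (m∸n≤m _ 1) (m∸n≤m (2 ^ suc b) 1)) ⟩
    2 ^ a + 2 * 2 ^ b                 ≤⟨ +-monoʳ-≤ (2 ^ a) (*-monoʳ-≤ 2 (^-monoʳ-≤ 2 b≤a)) ⟩
    2 ^ a + 2 * 2 ^ a                 ≡⟨ triple (2 ^ a) ⟩
    3 * 2 ^ a                         ∎
    where
    open ≤-Reasoning
    b≤a : b ≤ a
    b≤a = subst (b ≤_) ⌈k/2⌉≡ (⌊n/2⌋≤⌈n/2⌉ k)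
    triple : ∀ x → x + 2 * x ≡ 3 * x
    triple = solve-∀

rV≤2^2^[∣V∣⊓j] : ∀ {n} (f : BoolFun n) V j → n ≤ 2 ^ j → rV V f ≤ 2 ^ 2 ^ (∣ V ∣ ⊓ j)
rV≤2^2^[∣V∣⊓j] f V j n≤ with ∣ V ∣ ≤? j
... | yes ∣V∣≤j rewrite m≤n⇒m⊓n≡m ∣V∣≤j = rV≤2^2^∣V∣ f V
... | no ∣V∣≰j rewrite m≥n⇒m⊓n≡n (<⇒≤ (≰⇒> ∣V∣≰j)) = ≤-trans (rV≤2^n f V) (^-monoʳ-≤ 2 n≤)

IsMinSize⇒≤ : ∀ {M m r σ S} → IsMinSize M m r σ → MsemAtLeast M m S r → σ ≤ S
IsMinSize⇒≤ {σ = σ} {S} (_ , minimal) atS = ≮⇒≥ λ S<σ → minimal S S<σ atS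

ObtainedBySimpleNec⇒L*log≤ : ∀ M {n} (g : BoolFun n) L → ObtainedBySimpleNec M g L → 1 ≤ n →
                             L * ⌊log₂ n ⌋ ≤ 8 * (2 ^ ⌈ ⌊log₂ n ⌋ /2⌉ * n)
ObtainedBySimpleNec⇒L*log≤ M {n} g L (dependsOnAll , b , (_ , necFun) , p , π , surj , L≡) 1≤n =
  decidable-stable (_ ≤? _) (¬¬-map bound (¬¬-finiteChoice p λ i → ¬¬-least _ (atCost i)))
  where
  ℓ = ⌊log₂ n ⌋
  r : Fin p → ℕ
  r i = rV (block π i) g
  cost : Fin p → ℕ
  cost i = 3 * 2 ^ ⌈ blockSize π i ⊓ suc ℓ /2⌉
  atCost : ∀ i → MsemAtLeast M (blockSize π i) (cost i) (r i)
  atCost i = MsemAtLeast-2^2^k M (blockSize π i) _ (⊓-glb (Surj⇒1≤blockSize π surj i) (s≤s z≤n)) (m⊓n≤m _ _) (r i)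
               (rV≤2^2^[∣V∣⊓j] g (block π i) (suc ℓ) (<⇒≤ (proj₂ (⌊log₂⌋-bounds n 1≤n))))
  bound : (Σ (Fin p → ℕ) λ σ → ∀ i → IsMinSize M (blockSize π i) (r i) (σ i)) → L * ℓ ≤ 8 * (2 ^ ⌈ ℓ /2⌉ * n)
  bound (σ , minimal) = begin
    L * ℓ                                        ≡⟨ cong (_* ℓ) L≡ ⟩
    sumFin p (b ∘ r) * ℓ                         ≤⟨ *-monoˡ-≤ ℓ (necFun n g dependsOnAll p π surj σ minimal) ⟩
    sumFin p (λ i → blockSize π i ⊔ σ i) * ℓ     ≤⟨ *-monoˡ-≤ ℓ (sumFin-mono-≤ p σ≤cost) ⟩
    sumFin p (λ i → blockSize π i + cost i) * ℓ  ≡⟨ *-comm _ ℓ ⟩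
    ℓ * sumFin p (λ i → blockSize π i + cost i)  ≤⟨ sumFin-blockCost≤ π surj ℓ ⟩
    8 * (2 ^ ⌈ ℓ /2⌉ * n)                        ∎
    where
    open ≤-Reasoning
    σ≤cost : ∀ i → blockSize π i ⊔ σ i ≤ blockSize π i + cost i
    σ≤cost i = ≤-trans (m⊔n≤m+n (blockSize π i) (σ i)) (+-monoʳ-≤ (blockSize π i) (IsMinSize⇒≤ {M} (minimal i) (atCost i)))

[8*2^⌈ℓ/2⌉*n]^2≤128*n^3 : ∀ ℓ n → 2 ^ ℓ ≤ n → (8 * (2 ^ ⌈ ℓ /2⌉ * n)) ^ 2 ≤ 128 * n ^ 3
[8*2^⌈ℓ/2⌉*n]^2≤128*n^3 ℓ n 2^ℓ≤n = begin
  (8 * (Q * n)) ^ 2      ≡⟨ expand Q n ⟩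
  64 * (Q * Q * (n * n)) ≤⟨ *-monoʳ-≤ 64 (*-monoˡ-≤ (n * n) (≤-trans (2^⌈ℓ/2⌉*2^⌈ℓ/2⌉≤2*2^ℓ ℓ) (*-monoʳ-≤ 2 2^ℓ≤n))) ⟩
  64 * (2 * n * (n * n)) ≡⟨ collect n ⟩
  128 * n ^ 3            ∎
  where
  open ≤-Reasoning
  Q = 2 ^ ⌈ ℓ /2⌉
  expand : ∀ q y → 8 * (q * y) * (8 * (q * y) * 1) ≡ 64 * (q * q * (y * y))
  expand = solve-∀
  collect : ∀ y → 64 * (2 * y * (y * y)) ≡ 128 * (y * (y * (y * 1)))
  collect = solve-∀

theorem3p8 : (M : Model) (f : (n : ℕ) → BoolFun n) (L : ℕ → ℕ) →
    (∀ n → ObtainedBySimpleNec M (f n) (L n)) →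
    ∃[ C ] ∃[ n₀ ] (∀ n → n₀ ≤ n → (L n * ⌊log₂ n ⌋) ^ 2 ≤ C * n ^ 3)
theorem3p8 M f L obtained = 128 , 1 , λ n 1≤n → begin
  (L n * ⌊log₂ n ⌋) ^ 2                  ≤⟨ ^-monoˡ-≤ 2 (ObtainedBySimpleNec⇒L*log≤ M (f n) (L n) (obtained n) 1≤n) ⟩
  (8 * (2 ^ ⌈ ⌊log₂ n ⌋ /2⌉ * n)) ^ 2    ≤⟨ [8*2^⌈ℓ/2⌉*n]^2≤128*n^3 ⌊log₂ n ⌋ n (proj₁ (⌊log₂⌋-bounds n 1≤n)) ⟩
  128 * n ^ 3                            ∎
  where open ≤-Reasoning
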